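{- For polymatroids ${\bf X}=(X,\operatorname{rk}_X)$ and ${\bf Y}=(Y,\operatorname{rk}_Y)$ we have $\mathcal{P}[{\bf X}\oplus{\bf Y}]=\mathcal{P}[{\bf X}]\cdot\mathcal{P}[{\bf Y}]$ and $\mathcal{H}[{\bf X}\oplus{\bf Y}](q,t)=\mathcal{H}[{\bf X}](q,t)\cdot\mathcal{H}[{\bf Y}](q,t)$.
   Context: A polymatroid is ${\bf X}=(X,\operatorname{rk})$, $X$ finite, $\operatorname{rk}$ from subsets of $X$ to $\{0,1,2,\dots\}$ with $\operatorname{rk}(\emptyset)=0$, monotone and submodular; ${\bf X}|_A=(A,\operatorname{rk}|_A)$. The direct sum ${\bf X}\oplus{\bf Y}$ is the polymatroid on the disjoint union $X\sqcup Y$ with $\operatorname{rk}(A\cup B)=\operatorname{rk}_X(A)+\operatorname{rk}_Y(B)$ for $A\subseteq X$, $B\subseteq Y$. $\mathrm{Sym}=\mathbb{Z}[e_1,e_2,\dots]$ is the graded ring of symmetric functions with Schur basis $s_\lambda$, $\overline{\mathrm{Sym}}=\mathbb{Z}[[e_1,e_2,\dots]]$, $\sigma=1+s_1+s_2+\cdots\in\overline{\mathrm{Sym}}$. $\mathcal{P}[{\bf X}]\in\mathrm{Sym}$ is defined recursively: $\mathcal{P}[{\bf X}]=1$ if $X=\emptyset$; otherwise it is the sum of the homogeneous components of degrees $0,\dots,|X|-1$ of $-\sum_{A\subsetneq X}\mathcal{P}[{\bf X}|_A]\sigma^{\operatorname{rk}(X)-\operatorname{rk}(A)}(-1)^{|X|-|A|}$.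 $\mathcal{H}[{\bf X}](q,t)=\sum_{A\subseteq X}\mathcal{P}[{\bf X}|_A]q^{\operatorname{rk}(A)}t^{|A|}\in\mathbb{Z}[q,t]\otimes\mathrm{Sym}$. -}

module Defs where

open import Data.Nat as ℕ using (ℕ; zero; suc; _≤_; _∸_; _<ᵇ_; _≡ᵇ_)
open import Data.Integer as ℤ using (ℤ; +_; -_)
open import Data.Bool using (Bool; true; false; if_then_else_; _∧_; not)
open import Data.List using (List; []; _∷_; _++_; map; foldr; concatMap; filterᵇ; upTo; applyUpTo; zipWith)
open import Data.Nat.ListAction using (sum)
open import Data.Product using (_×_; _,_; proj₁; proj₂)
open import Data.Vec as Vec using (Vec; []; _∷_)
open import Data.Fin.Subset using (Subset; ⊥; ⊤; _∪_; _∩_; _⊆_; ∣_∣)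
open import Relation.Binary.PropositionalEquality using (_≡_)

record IsPolymatroid {n : ℕ} (rk : Subset n → ℕ) : Set where
  field
    rk-empty : rk ⊥ ≡ 0
    rk-mono  : ∀ A B → A ⊆ B → rk A ≤ rk B
    rk-submod : ∀ A B → rk (A ∪ B) ℕ.+ rk (A ∩ B) ≤ rk A ℕ.+ rk B

-- Direct sum: ground set Fin (m + n) = Fin m ⊔ Fin n (first m elements
-- belong to X, the last n to Y); rk (A ∪ B) = rkX A + rkY B.
directSum : ∀ {m n} → (Subset m → ℕ) → (Subset n → ℕ) → Subset (m ℕ.+ n) → ℕ
directSum {m} rkX rkY S = rkX (Vec.take m S) ℕ.+ rkY (Vec.drop m S)

-- Sym = ℤ[e₁, e₂, …]: a finite ℤ-linear combination of monomials
-- e_{λ₁} e_{λ₂} ⋯ ; a monomial is a weakly decreasing list of positive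
-- integers (a partition λ).

Mono : Set
Mono = List ℕ

Sym : Set
Sym = List (ℤ × Mono)

insertD : ℕ → Mono → Mono
insertD x [] = x ∷ []
insertD x (y ∷ ys) = if y <ᵇ x then x ∷ y ∷ ys else y ∷ insertD x ys

mulMono : Mono → Mono → Mono
mulMono m₁ m₂ = foldr insertD m₂ m₁

eqMonoᵇ : Mono → Mono → Bool
eqMonoᵇ [] [] = true
eqMonoᵇ [] (_ ∷ _) = false
eqMonoᵇ (_ ∷ _) [] = false
eqMonoᵇ (x ∷ xs) (y ∷ ys) = (x ≡ᵇ y) ∧ eqMonoᵇ xs ys

coeff : Sym → Mono → ℤ
coeff p μ = foldr (λ t r → if eqMonoᵇ (proj₂ t) μ then proj₁ t ℤ.+ r else r) (+ 0) p

_≈S_ : Sym → Sym → Set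
p ≈S q = ∀ μ → coeff p μ ≡ coeff q μ

0S : Sym
0S = []

1S : Sym
1S = (+ 1 , []) ∷ []

e : ℕ → Sym
e zero = 1S
e (suc i) = (+ 1 , suc i ∷ []) ∷ []

_+S_ : Sym → Sym → Sym
_+S_ = _++_

scaleS : ℤ → Sym → Sym
scaleS c = map (λ t → (c ℤ.* proj₁ t , proj₂ t))

negS : Sym → Sym
negS = scaleS (- (+ 1))

_*S_ : Sym → Sym → Sym
p *S q = concatMap (λ t → map (λ u → (proj₁ t ℤ.* proj₁ u , mulMono (proj₂ t) (proj₂ u))) q) p

sumS : List Sym → Sym
sumS = foldr _+S_ 0S

homog : ℕ → Sym → Sym
homog k = filterᵇ (λ t → sum (proj₂ t) ≡ᵇ k)

sgn : ℕ → ℤ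
sgn zero = + 1
sgn (suc k) = - sgn k

-- complete homogeneous symmetric functions h_k = s_(k), defined in
-- Sym = ℤ[e] by h₀ = 1, h_k = Σ_{i=1}^{k} (-1)^{i-1} e_i h_{k-i}.
-- hRev k = h_k ∷ h_{k-1} ∷ … ∷ h₀ ∷ []
hRev : ℕ → List Sym
hRev zero = 1S ∷ []
hRev (suc k) = sumS (zipWith (λ i hp → scaleS (sgn (i ∸ 1)) (e i *S hp)) (applyUpTo suc (suc k)) (hRev k)) ∷ hRev k

headS : List Sym → Sym
headS [] = 0S
headS (x ∷ _) = x

h : ℕ → Sym
h k = headS (hRev k)

-- The completion \overline{Sym} = ℤ[[e₁,e₂,…]], as sequences of
-- homogeneous components (component k has degree k).

Series : Set
Series = ℕ → Sym

embed : Sym → Series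
embed p k = homog k p

-- σ = 1 + s₁ + s₂ + ⋯ = Σ_k h_k
σ : Series
σ k = h k

mulSer : Series → Series → Series
mulSer f g k = sumS (map (λ i → f i *S g (k ∸ i)) (upTo (suc k)))

powSer : Series → ℕ → Series
powSer f zero = embed 1S
powSer f (suc r) = mulSer f (powSer f r)

scaleSer : ℤ → Series → Series
scaleSer c f k = scaleS c (f k)

sumSer : List Series → Series
sumSer fs k = sumS (map (λ f → f k) fs)

negSer : Series → Series
negSer f k = negS (f k)

allSubsets : ∀ n → List (Subset n)
allSubsets zero = [] ∷ []
allSubsets (suc n) = map (true ∷_) (allSubsets n) ++ map (false ∷_) (allSubsets n)

subsetᵇ : ∀ {n} → Subset n → Subset n → Bool
subsetᵇ [] [] = true
subsetᵇ (false ∷ xs) (_ ∷ ys) = subsetᵇ xs ys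
subsetᵇ (true ∷ xs) (y ∷ ys) = y ∧ subsetᵇ xs ys

eqSubᵇ : ∀ {n} → Subset n → Subset n → Bool
eqSubᵇ A B = subsetᵇ A B ∧ subsetᵇ B A

properSubᵇ : ∀ {n} → Subset n → Subset n → Bool
properSubᵇ B A = subsetᵇ B A ∧ not (eqSubᵇ B A)

-- 𝒫[X|_A] for A ⊆ X, by recursion (fuel k ≥ |A|).
-- 𝒫[X|_A] = 1 if A = ∅, otherwise the components of degrees 0..|A|-1 of
--   - Σ_{B ⊊ A} 𝒫[X|_B] σ^{rk A - rk B} (-1)^{|A|-|B|}.

Pfuel : ∀ {n} → (Subset n → ℕ) → ℕ → Subset n → Sym
Pfuel rk zero A = 1S
Pfuel {n} rk (suc k) A =
  if ∣ A ∣ ≡ᵇ 0 then 1S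
  else sumS (map S (upTo ∣ A ∣))
  where
  S : Series
  S = negSer (sumSer (map (λ B → scaleSer (sgn (∣ A ∣ ∸ ∣ B ∣))
                                   (mulSer (embed (Pfuel rk k B)) (powSer σ (rk A ∸ rk B))))
                          (filterᵇ (λ B → properSubᵇ B A) (allSubsets n))))

Prestr : ∀ {n} → (Subset n → ℕ) → Subset n → Sym
Prestr {n} rk A = Pfuel rk n A

𝒫 : ∀ {n} → (Subset n → ℕ) → Sym
𝒫 rk = Prestr rk ⊤

-- ℤ[q,t] ⊗ Sym : finite sums of terms q^a t^b p

QTSym : Set
QTSym = List (ℕ × ℕ × Sym)

coeffQT : QTSym → ℕ → ℕ → Mono → ℤ
coeffQT f a b μ =
  foldr (λ t r → if (proj₁ t ≡ᵇ a) ∧ (proj₁ (proj₂ t) ≡ᵇ b)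
                 then coeff (proj₂ (proj₂ t)) μ ℤ.+ r else r) (+ 0) f

_≈QT_ : QTSym → QTSym → Set
f ≈QT g = ∀ a b μ → coeffQT f a b μ ≡ coeffQT g a b μ

_*QT_ : QTSym → QTSym → QTSym
f *QT g = concatMap (λ x → map (λ y → (proj₁ x ℕ.+ proj₁ y ,
                                       proj₁ (proj₂ x) ℕ.+ proj₁ (proj₂ y) ,
                                       proj₂ (proj₂ x) *S proj₂ (proj₂ y))) g) f

ℋ : ∀ {n} → (Subset n → ℕ) → QTSym
ℋ {n} rk = map (λ A → (rk A , ∣ A ∣ , Prestr rk A)) (allSubsets n)

-- Pair a polynomial p with test functions G : Mono → ℤ by ⟪ p ⟫ G = Σ c·G(μ);
-- polynomials with the same pairings have the same coefficients, so every identity becomes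
-- one between integer sums.  For A ≠ ∅ the recursion says that 𝒫[A] has degree < |A| and
-- that U[A] = Σ_{B ⊆ A} (-1)^{|A|-|B|} 𝒫[B] σ^{rk A - rk B} has no terms of degree < |A|.
-- For A ⊔ B, by induction and additivity of rank and cardinality every summand of U[A ⊔ B]
-- except the top one is the product of the summands for A and for B, while U[A]·U[B] has
-- no terms of degree < |A| + |B|.  Hence 𝒫[A ⊔ B] and 𝒫[A]·𝒫[B] agree in all degrees
-- below |A| + |B|, where both live.  ℋ follows by summing over the pairs (A, B).

module Submission where

open import Defs
open import Data.Bool using (Bool; true; false; if_then_else_; _∧_; not; T; T?)
open import Data.Bool.Properties using (T-∧; ∧-zeroʳ; ∧-assoc)
open import Data.Empty using (⊥)
open import Data.Fin.Subset using (Subset; ⊤; ∣_∣)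
import Data.Fin.Subset as Sub
import Data.Fin.Subset.Properties as Subₚ
open import Data.Integer using (ℤ; +_; -_; _+_; _*_; _-_)
import Data.Integer.Properties as ℤₚ
open import Data.Integer.Tactic.RingSolver using (solve-∀)
open import Data.List using (List; []; _∷_; _++_; map; concatMap; filterᵇ; upTo; applyUpTo; zipWith)
import Data.List.Properties as Listₚ
open import Data.List.Relation.Unary.All as All using (All; []; _∷_)
open import Data.List.Relation.Unary.All.Properties using (++⁺; map⁺; concat⁺; all-filter; filter⁺; applyUpTo⁺₁)
open import Data.Nat as ℕ using (ℕ; zero; suc; _≤_; _<_; _∸_; _<ᵇ_; _≡ᵇ_; z≤n; s≤s)
import Data.Nat.Properties as ℕₚ
open import Data.Nat.ListAction using (sum)
open import Data.Product using (_×_; _,_; proj₁; proj₂)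
open import Data.Unit using (tt) renaming (⊤ to Unit)
open import Data.Vec as Vec using ([]; _∷_)
open import Data.Vec.Base using (here; there)
import Data.Vec.Properties as Vecₚ
open import Function using (_∘_; Equivalence)
open import Level using (0ℓ)
open import Relation.Binary.Bundles using (Setoid)
import Relation.Binary.Reasoning.Setoid as SetoidReasoning
open import Relation.Binary.PropositionalEquality
open import Relation.Nullary using (yes; no; contradiction; proof)
open import Relation.Nullary.Reflects using (Reflects; ofʸ; ofⁿ)

infix 2 ∑

∑ : {A : Set} → List A → (A → ℤ) → ℤ
∑ []       f = + 0
∑ (x ∷ xs) f = f x + ∑ xs f

syntax ∑ xs (λ x → t) = ∑[ x ∈ xs ] t

module _ {A : Set} where

  ∑-cong : ∀ (xs : List A) {f g : A → ℤ} → (∀ x → f x ≡ g x) → ∑ xs f ≡ ∑ xs g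
  ∑-cong []       f≗g = refl
  ∑-cong (x ∷ xs) f≗g = cong₂ _+_ (f≗g x) (∑-cong xs f≗g)

  ∑-cong-All : ∀ {xs : List A} {f g : A → ℤ} → All (λ x → f x ≡ g x) xs → ∑ xs f ≡ ∑ xs g
  ∑-cong-All []            = refl
  ∑-cong-All (fx≡gx ∷ eqs) = cong₂ _+_ fx≡gx (∑-cong-All eqs)

  ∑-++ : ∀ (xs ys : List A) f → ∑ (xs ++ ys) f ≡ ∑ xs f + ∑ ys f
  ∑-++ []       ys f = sym (ℤₚ.+-identityˡ _)
  ∑-++ (x ∷ xs) ys f = trans (cong (_+_ (f x)) (∑-++ xs ys f)) (sym (ℤₚ.+-assoc (f x) _ _))

  ∑-0 : ∀ (xs : List A) → (∑[ _ ∈ xs ] + 0) ≡ + 0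
  ∑-0 []       = refl
  ∑-0 (x ∷ xs) = trans (ℤₚ.+-identityˡ _) (∑-0 xs)

  ∑-+ : ∀ (xs : List A) f g → (∑[ x ∈ xs ] (f x + g x)) ≡ ∑ xs f + ∑ xs g
  ∑-+ []       f g = refl
  ∑-+ (x ∷ xs) f g = trans (cong (_+_ (f x + g x)) (∑-+ xs f g)) (interchange (f x) (g x) _ _)
    where
    interchange : ∀ a b c d → (a + b) + (c + d) ≡ (a + c) + (b + d)
    interchange = solve-∀

  ∑-*ˡ : ∀ (xs : List A) c f → (∑[ x ∈ xs ] (c * f x)) ≡ c * ∑ xs f
  ∑-*ˡ []       c f = sym (ℤₚ.*-zeroʳ c)
  ∑-*ˡ (x ∷ xs) c f = trans (cong (_+_ (c * f x)) (∑-*ˡ xs c f)) (sym (ℤₚ.*-distribˡ-+ c (f x) _))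

  ∑-neg : ∀ (xs : List A) f → (∑[ x ∈ xs ] - f x) ≡ - ∑ xs f
  ∑-neg []       f = refl
  ∑-neg (x ∷ xs) f = trans (cong (_+_ (- f x)) (∑-neg xs f)) (sym (ℤₚ.neg-distrib-+ (f x) _))

  ∑-- : ∀ (xs : List A) f g → (∑[ x ∈ xs ] (f x - g x)) ≡ ∑ xs f - ∑ xs g
  ∑-- xs f g = trans (∑-+ xs f (λ x → - g x)) (cong (_+_ (∑ xs f)) (∑-neg xs g))

  ∑-if : ∀ (xs : List A) b f → (∑[ x ∈ xs ] (if b then f x else + 0)) ≡ (if b then ∑ xs f else + 0)
  ∑-if xs true  f = refl
  ∑-if xs false f = ∑-0 xs

  ∑-filterᵇ : ∀ (P : A → Bool) xs f → ∑ (filterᵇ P xs) f ≡ (∑[ x ∈ xs ] (if P x then f x else + 0))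
  ∑-filterᵇ P []       f = refl
  ∑-filterᵇ P (x ∷ xs) f with P x
  ... | true  = cong (_+_ (f x)) (∑-filterᵇ P xs f)
  ... | false = trans (∑-filterᵇ P xs f) (sym (ℤₚ.+-identityˡ _))

∑-map : ∀ {A B : Set} (g : A → B) xs f → ∑ (map g xs) f ≡ ∑ xs (f ∘ g)
∑-map g []       f = refl
∑-map g (x ∷ xs) f = cong (_+_ (f (g x))) (∑-map g xs f)

∑-concatMap : ∀ {A B : Set} (g : A → List B) xs f → ∑ (concatMap g xs) f ≡ (∑[ x ∈ xs ] ∑ (g x) f)
∑-concatMap g []       f = refl
∑-concatMap g (x ∷ xs) f =
  trans (∑-++ (g x) (concatMap g xs) f) (cong (_+_ (∑ (g x) f)) (∑-concatMap g xs f))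

∑-comm : ∀ {A B : Set} (xs : List A) (ys : List B) (f : A → B → ℤ) →
  (∑[ x ∈ xs ] ∑[ y ∈ ys ] f x y) ≡ (∑[ y ∈ ys ] ∑[ x ∈ xs ] f x y)
∑-comm []       ys f = sym (∑-0 ys)
∑-comm (x ∷ xs) ys f = trans (cong (_+_ (∑ ys (f x))) (∑-comm xs ys f)) (sym (∑-+ ys (f x) _))

∑-applyUpTo : ∀ {A : Set} (g : ℕ → A) n f → ∑ (applyUpTo g n) f ≡ ∑ (upTo n) (f ∘ g)
∑-applyUpTo g zero    f = refl
∑-applyUpTo g (suc n) f =
  cong (_+_ (f (g 0))) (trans (∑-applyUpTo (g ∘ suc) n f) (sym (∑-applyUpTo suc n (f ∘ g))))

∑-upTo-suc : ∀ n (f : ℕ → ℤ) → ∑ (upTo (suc n)) f ≡ f 0 + ∑ (upTo n) (f ∘ suc)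
∑-upTo-suc n f = cong (_+_ (f 0)) (∑-applyUpTo suc n f)

∑-upTo-indicator : ∀ n s (Y : ℕ → ℤ) →
  (∑[ i ∈ upTo n ] (if s ≡ᵇ i then Y i else + 0)) ≡ (if s <ᵇ n then Y s else + 0)
∑-upTo-indicator zero    s       Y = refl
∑-upTo-indicator (suc n) zero    Y =
  trans (∑-upTo-suc n (λ i → if 0 ≡ᵇ i then Y i else + 0)) (trans (cong (_+_ (Y 0)) (∑-0 (upTo n))) (ℤₚ.+-identityʳ (Y 0)))
∑-upTo-indicator (suc n) (suc s) Y =
  trans (∑-upTo-suc n (λ i → if suc s ≡ᵇ i then Y i else + 0)) (trans (ℤₚ.+-identityˡ _) (∑-upTo-indicator n s (Y ∘ suc)))

≡ᵇ-reflects-≡ : ∀ m n → Reflects (m ≡ n) (m ≡ᵇ n)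
≡ᵇ-reflects-≡ m n = proof (m ℕ.≟ n)

∑-upTo-convolution : ∀ d s t (g : ℤ) →
  (∑[ i ∈ upTo (suc d) ] (if s ≡ᵇ i then (if t ≡ᵇ d ∸ i then g else + 0) else + 0))
    ≡ (if s ℕ.+ t ≡ᵇ d then g else + 0)
∑-upTo-convolution d s t g = trans (∑-upTo-indicator (suc d) s _) s-first
  where
  s-first : (if s <ᵇ suc d then (if t ≡ᵇ d ∸ s then g else + 0) else + 0) ≡ (if s ℕ.+ t ≡ᵇ d then g else + 0)
  s-first with s <ᵇ suc d | ℕₚ.<ᵇ-reflects-< s (suc d)
             | t ≡ᵇ d ∸ s | ≡ᵇ-reflects-≡ t (d ∸ s) | s ℕ.+ t ≡ᵇ d | ≡ᵇ-reflects-≡ (s ℕ.+ t) d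
  ... | true  | ofʸ s<1+d | true  | ofʸ t≡d∸s | false | ofⁿ s+t≢d =
    contradiction (trans (cong (s ℕ.+_) t≡d∸s) (ℕₚ.m+[n∸m]≡n (ℕₚ.≤-pred s<1+d))) s+t≢d
  ... | true  | _         | false | ofⁿ t≢d∸s | true  | ofʸ s+t≡d =
    contradiction (trans (sym (ℕₚ.m+n∸m≡n s t)) (cong (_∸ s) s+t≡d)) t≢d∸s
  ... | false | ofⁿ s≮1+d | _     | _         | true  | ofʸ s+t≡d =
    contradiction (s≤s (subst (s ≤_) s+t≡d (ℕₚ.m≤m+n s t))) s≮1+d
  ... | true  | _ | true  | _ | true  | _ = refl
  ... | true  | _ | false | _ | false | _ = refl
  ... | false | _ | _     | _ | false | _ = refl

⟪_⟫ : Sym → (Mono → ℤ) → ℤ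
⟪ p ⟫ G = ∑[ t ∈ p ] proj₁ t * G (proj₂ t)

atDegree : ℕ → (Mono → ℤ) → Mono → ℤ
atDegree d G m = if sum m ≡ᵇ d then G m else + 0

*-if : ∀ c b (g : ℤ) → c * (if b then g else + 0) ≡ (if b then c * g else + 0)
*-if c true  g = refl
*-if c false g = ℤₚ.*-zeroʳ c

⟪⟫-cong : ∀ p {F G} → (∀ m → F m ≡ G m) → ⟪ p ⟫ F ≡ ⟪ p ⟫ G
⟪⟫-cong p F≗G = ∑-cong p (λ t → cong (proj₁ t *_) (F≗G (proj₂ t)))

⟪++⟫ : ∀ p q G → ⟪ p ++ q ⟫ G ≡ ⟪ p ⟫ G + ⟪ q ⟫ G
⟪++⟫ p q G = ∑-++ p q _

⟪scaleS⟫ : ∀ c p G → ⟪ scaleS c p ⟫ G ≡ c * ⟪ p ⟫ G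
⟪scaleS⟫ c p G =
  trans (∑-map _ p _) (trans (∑-cong p (λ t → ℤₚ.*-assoc c (proj₁ t) _)) (∑-*ˡ p c _))

⟪negS⟫ : ∀ p G → ⟪ negS p ⟫ G ≡ - ⟪ p ⟫ G
⟪negS⟫ p G = trans (⟪scaleS⟫ (- + 1) p G) (ℤₚ.-1*i≡-i _)

⟪*S⟫ : ∀ p q G → ⟪ p *S q ⟫ G ≡ ⟪ p ⟫ (λ m → ⟪ q ⟫ (G ∘ mulMono m))
⟪*S⟫ p q G = trans (∑-concatMap _ p _) (∑-cong p λ t →
  trans (∑-map _ q _) (trans (∑-cong q (λ u → ℤₚ.*-assoc (proj₁ t) (proj₁ u) _)) (∑-*ˡ q (proj₁ t) _)))

⟪sumS⟫ : ∀ ps G → ⟪ sumS ps ⟫ G ≡ (∑[ p ∈ ps ] ⟪ p ⟫ G)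
⟪sumS⟫ []       G = refl
⟪sumS⟫ (p ∷ ps) G = trans (⟪++⟫ p (sumS ps) G) (cong (_+_ (⟪ p ⟫ G)) (⟪sumS⟫ ps G))

⟪sumS-map⟫ : ∀ {A : Set} (F : A → Sym) xs G → ⟪ sumS (map F xs) ⟫ G ≡ (∑[ x ∈ xs ] ⟪ F x ⟫ G)
⟪sumS-map⟫ F xs G = trans (⟪sumS⟫ (map F xs) G) (∑-map F xs _)

⟪homog⟫ : ∀ d p G → ⟪ homog d p ⟫ G ≡ ⟪ p ⟫ (atDegree d G)
⟪homog⟫ d p G = trans (∑-filterᵇ _ p _) (∑-cong p λ t → sym (*-if (proj₁ t) (sum (proj₂ t) ≡ᵇ d) _))

⟪1S⟫ : ∀ G → ⟪ 1S ⟫ G ≡ G []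
⟪1S⟫ G = trans (ℤₚ.+-identityʳ _) (ℤₚ.*-identityˡ _)

⟪⟫-0ᴳ : ∀ p → ⟪ p ⟫ (λ _ → + 0) ≡ + 0
⟪⟫-0ᴳ p = trans (∑-cong p (λ t → ℤₚ.*-zeroʳ (proj₁ t))) (∑-0 p)

⟪⟫-*ᴳ : ∀ p c F → ⟪ p ⟫ (λ m → c * F m) ≡ c * ⟪ p ⟫ F
⟪⟫-*ᴳ p c F = trans (∑-cong p (λ t → left-comm (proj₁ t) c _)) (∑-*ˡ p c _)
  where
  left-comm : ∀ a b d → a * (b * d) ≡ b * (a * d)
  left-comm = solve-∀

⟪⟫-∑ᴳ : ∀ {A : Set} p (xs : List A) (F : A → Mono → ℤ) → ⟪ p ⟫ (λ m → ∑[ x ∈ xs ] F x m) ≡ (∑[ x ∈ xs ] ⟪ p ⟫ (F x))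
⟪⟫-∑ᴳ p xs F = trans (∑-cong p (λ t → sym (∑-*ˡ xs (proj₁ t) _))) (∑-comm p xs _)

⟪⟫-ifᴳ : ∀ p b F → ⟪ p ⟫ (λ m → if b then F m else + 0) ≡ (if b then ⟪ p ⟫ F else + 0)
⟪⟫-ifᴳ p true  F = refl
⟪⟫-ifᴳ p false F = ⟪⟫-0ᴳ p

⟪⟫-comm : ∀ p q (F : Mono → Mono → ℤ) → ⟪ p ⟫ (λ m → ⟪ q ⟫ (F m)) ≡ ⟪ q ⟫ (λ n → ⟪ p ⟫ (λ m → F m n))
⟪⟫-comm p q F =
  trans (⟪⟫-∑ᴳ p q (λ u m → proj₁ u * F m (proj₂ u))) (∑-cong q (λ u → ⟪⟫-*ᴳ p (proj₁ u) _))

infix 4 _≃_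

record _≃_ (p q : Sym) : Set where
  constructor mk≃
  field agree : ∀ G → ⟪ p ⟫ G ≡ ⟪ q ⟫ G

open _≃_

≃-setoid : Setoid 0ℓ 0ℓ
≃-setoid = record
  { Carrier       = Sym
  ; _≈_           = _≃_
  ; isEquivalence = record
    { refl  = mk≃ λ _ → refl
    ; sym   = λ p≃q → mk≃ λ G → sym (agree p≃q G)
    ; trans = λ p≃q q≃r → mk≃ λ G → trans (agree p≃q G) (agree q≃r G)
    }
  }

open Setoid ≃-setoid using () renaming (refl to ≃-refl; sym to ≃-sym; trans to ≃-trans)

module ≃-Reasoning = SetoidReasoning ≃-setoid

-- Pairing with the indicator of μ reads off the coefficient of μ.
≃⇒≈S : ∀ {p q} → p ≃ q → p ≈S q
≃⇒≈S {p} {q} p≃q μ = trans (coeff≡⟪δ⟫ p) (trans (agree p≃q _) (sym (coeff≡⟪δ⟫ q)))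
  where
  coeff≡⟪δ⟫ : ∀ r → coeff r μ ≡ ⟪ r ⟫ (λ m → if eqMonoᵇ m μ then + 1 else + 0)
  coeff≡⟪δ⟫ []            = refl
  coeff≡⟪δ⟫ ((c , m) ∷ r) with eqMonoᵇ m μ
  ... | true  = cong₂ _+_ (sym (ℤₚ.*-identityʳ c)) (coeff≡⟪δ⟫ r)
  ... | false = trans (coeff≡⟪δ⟫ r) (sym (trans (cong (_+ _) (ℤₚ.*-zeroʳ c)) (ℤₚ.+-identityˡ _)))

*S-cong : ∀ {p p′ q q′} → p ≃ p′ → q ≃ q′ → p *S q ≃ p′ *S q′
*S-cong {p} {p′} {q} {q′} p≃p′ q≃q′ = mk≃ λ G → begin
  ⟪ p *S q ⟫ G                             ≡⟨ ⟪*S⟫ p q G ⟩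
  ⟪ p ⟫ (λ m → ⟪ q ⟫ (G ∘ mulMono m))      ≡⟨ agree p≃p′ _ ⟩
  ⟪ p′ ⟫ (λ m → ⟪ q ⟫ (G ∘ mulMono m))     ≡⟨ ⟪⟫-cong p′ (λ m → agree q≃q′ _) ⟩
  ⟪ p′ ⟫ (λ m → ⟪ q′ ⟫ (G ∘ mulMono m))    ≡⟨ ⟪*S⟫ p′ q′ G ⟨
  ⟪ p′ *S q′ ⟫ G                           ∎
  where open ≡-Reasoning

scaleS-cong : ∀ c {p q} → p ≃ q → scaleS c p ≃ scaleS c q
scaleS-cong c {p} {q} p≃q = mk≃ λ G →
  trans (⟪scaleS⟫ c p G) (trans (cong (c *_) (agree p≃q G)) (sym (⟪scaleS⟫ c q G)))

scaleS-*-scaleS : ∀ c d p q → scaleS c p *S scaleS d q ≃ scaleS (c * d) (p *S q)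
scaleS-*-scaleS c d p q = mk≃ λ G → begin
  ⟪ scaleS c p *S scaleS d q ⟫ G                         ≡⟨ ⟪*S⟫ (scaleS c p) (scaleS d q) G ⟩
  ⟪ scaleS c p ⟫ (λ m → ⟪ scaleS d q ⟫ (G ∘ mulMono m))  ≡⟨ ⟪scaleS⟫ c p _ ⟩
  c * ⟪ p ⟫ (λ m → ⟪ scaleS d q ⟫ (G ∘ mulMono m))       ≡⟨ cong (c *_) (⟪⟫-cong p (λ m → ⟪scaleS⟫ d q _)) ⟩
  c * ⟪ p ⟫ (λ m → d * ⟪ q ⟫ (G ∘ mulMono m))            ≡⟨ cong (c *_) (⟪⟫-*ᴳ p d _) ⟩
  c * (d * ⟪ p ⟫ (λ m → ⟪ q ⟫ (G ∘ mulMono m)))          ≡⟨ ℤₚ.*-assoc c d _ ⟨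
  c * d * ⟪ p ⟫ (λ m → ⟪ q ⟫ (G ∘ mulMono m))            ≡⟨ cong (c * d *_) (⟪*S⟫ p q G) ⟨
  c * d * ⟪ p *S q ⟫ G                                   ≡⟨ ⟪scaleS⟫ (c * d) (p *S q) G ⟨
  ⟪ scaleS (c * d) (p *S q) ⟫ G                          ∎
  where open ≡-Reasoning

*S-identityˡ : ∀ p → 1S *S p ≃ p
*S-identityˡ p = mk≃ λ G → trans (⟪*S⟫ 1S p G) (⟪1S⟫ (λ m → ⟪ p ⟫ (G ∘ mulMono m)))

<ᵇ≡true⇒< : ∀ m n → (m <ᵇ n) ≡ true → m < n
<ᵇ≡true⇒< m n m<ᵇn = ℕₚ.<ᵇ⇒< m n (subst T (sym m<ᵇn) tt)

<ᵇ≡false⇒≥ : ∀ m n → (m <ᵇ n) ≡ false → n ≤ m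
<ᵇ≡false⇒≥ m n m≮ᵇn with m <ᵇ n | ℕₚ.<ᵇ-reflects-< m n | m≮ᵇn
... | false | ofⁿ m≮n | _ = ℕₚ.≮⇒≥ m≮n

≥⇒<ᵇ≡false : ∀ m n → n ≤ m → (m <ᵇ n) ≡ false
≥⇒<ᵇ≡false m n n≤m with m <ᵇ n | ℕₚ.<ᵇ-reflects-< m n
... | false | _       = refl
... | true  | ofʸ m<n = contradiction n≤m (ℕₚ.<⇒≱ m<n)

insertD-front : ∀ {x z} zs → (z <ᵇ x) ≡ true → insertD x (z ∷ zs) ≡ x ∷ z ∷ zs
insertD-front zs z<x rewrite z<x = refl

insertD-skip : ∀ {x z} zs → (z <ᵇ x) ≡ false → insertD x (z ∷ zs) ≡ z ∷ insertD x zs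
insertD-skip zs z≮x rewrite z≮x = refl

insertD-swap : ∀ x y w → insertD x w ≡ x ∷ w → insertD y w ≡ y ∷ w →
  insertD x (y ∷ w) ≡ insertD y (x ∷ w)
insertD-swap x y w x-front y-front
  with y <ᵇ x | ℕₚ.<ᵇ-reflects-< y x | x <ᵇ y | ℕₚ.<ᵇ-reflects-< x y
... | true  | ofʸ y<x | true  | ofʸ x<y = contradiction y<x (ℕₚ.<-asym x<y)
... | true  | _       | false | _       = cong (x ∷_) (sym y-front)
... | false | _       | true  | _       = cong (y ∷_) x-front
... | false | ofⁿ y≮x | false | ofⁿ x≮y
  with refl ← ℕₚ.≤-antisym (ℕₚ.≮⇒≥ y≮x) (ℕₚ.≮⇒≥ x≮y) = refl

insertD-comm : ∀ x y l → insertD x (insertD y l) ≡ insertD y (insertD x l)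
insertD-comm x y []       = insertD-swap x y [] refl refl
insertD-comm x y (z ∷ zs) = by-cases (z <ᵇ y) (z <ᵇ x) refl refl
  where
  open ≡-Reasoning
  one-before : ∀ x y → (z <ᵇ y) ≡ true → (z <ᵇ x) ≡ false →
    insertD x (insertD y (z ∷ zs)) ≡ insertD y (insertD x (z ∷ zs))
  one-before x y z<y x≤z = begin
    insertD x (insertD y (z ∷ zs))  ≡⟨ cong (insertD x) (insertD-front zs z<y) ⟩
    insertD x (y ∷ z ∷ zs)          ≡⟨ insertD-skip (z ∷ zs) y≮x ⟩
    y ∷ insertD x (z ∷ zs)          ≡⟨ cong (y ∷_) (insertD-skip zs x≤z) ⟩
    y ∷ z ∷ insertD x zs            ≡⟨ insertD-front (insertD x zs) z<y ⟨
    insertD y (z ∷ insertD x zs)    ≡⟨ cong (insertD y) (insertD-skip zs x≤z) ⟨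
    insertD y (insertD x (z ∷ zs))  ∎
    where
    y≮x = ≥⇒<ᵇ≡false y x (ℕₚ.<⇒≤ (ℕₚ.≤-<-trans (<ᵇ≡false⇒≥ z x x≤z) (<ᵇ≡true⇒< z y z<y)))
  by-cases : ∀ b c → (z <ᵇ y) ≡ b → (z <ᵇ x) ≡ c →
    insertD x (insertD y (z ∷ zs)) ≡ insertD y (insertD x (z ∷ zs))
  by-cases true  true  z<y z<x = begin
    insertD x (insertD y (z ∷ zs))  ≡⟨ cong (insertD x) (insertD-front zs z<y) ⟩
    insertD x (y ∷ z ∷ zs)          ≡⟨ insertD-swap x y (z ∷ zs) (insertD-front zs z<x) (insertD-front zs z<y) ⟩
    insertD y (x ∷ z ∷ zs)          ≡⟨ cong (insertD y) (insertD-front zs z<x) ⟨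
    insertD y (insertD x (z ∷ zs))  ∎
  by-cases true  false z<y x≤z = one-before x y z<y x≤z
  by-cases false true  y≤z z<x = sym (one-before y x z<x y≤z)
  by-cases false false y≤z x≤z = begin
    insertD x (insertD y (z ∷ zs))  ≡⟨ cong (insertD x) (insertD-skip zs y≤z) ⟩
    insertD x (z ∷ insertD y zs)    ≡⟨ insertD-skip (insertD y zs) x≤z ⟩
    z ∷ insertD x (insertD y zs)    ≡⟨ cong (z ∷_) (insertD-comm x y zs) ⟩
    z ∷ insertD y (insertD x zs)    ≡⟨ insertD-skip (insertD x zs) y≤z ⟨
    insertD y (z ∷ insertD x zs)    ≡⟨ cong (insertD y) (insertD-skip zs x≤z) ⟨
    insertD y (insertD x (z ∷ zs))  ∎

insertD-mulMono : ∀ x m n → insertD x (mulMono m n) ≡ mulMono m (insertD x n)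
insertD-mulMono x []      n = refl
insertD-mulMono x (y ∷ m) n =
  trans (insertD-comm x y (mulMono m n)) (cong (insertD y) (insertD-mulMono x m n))

mulMono-insertD : ∀ x m n → mulMono (insertD x m) n ≡ insertD x (mulMono m n)
mulMono-insertD x []      n = refl
mulMono-insertD x (y ∷ m) n = by-cases (y <ᵇ x) refl
  where
  by-cases : ∀ b → (y <ᵇ x) ≡ b → mulMono (insertD x (y ∷ m)) n ≡ insertD x (mulMono (y ∷ m) n)
  by-cases true  y<x = cong (λ l → mulMono l n) (insertD-front m y<x)
  by-cases false x≤y = trans (cong (λ l → mulMono l n) (insertD-skip m x≤y))
    (trans (cong (insertD y) (mulMono-insertD x m n)) (insertD-comm y x (mulMono m n)))

mulMono-assoc : ∀ a b c → mulMono (mulMono a b) c ≡ mulMono a (mulMono b c)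
mulMono-assoc []      b c = refl
mulMono-assoc (x ∷ a) b c =
  trans (mulMono-insertD x (mulMono a b) c) (cong (insertD x) (mulMono-assoc a b c))

mulMono-left-comm : ∀ a b c → mulMono a (mulMono b c) ≡ mulMono b (mulMono a c)
mulMono-left-comm []      b c = refl
mulMono-left-comm (x ∷ a) b c =
  trans (cong (insertD x) (mulMono-left-comm a b c)) (insertD-mulMono x b (mulMono a c))

mulMono-interchange : ∀ a b c d →
  mulMono (mulMono a b) (mulMono c d) ≡ mulMono (mulMono a c) (mulMono b d)
mulMono-interchange a b c d = begin
  mulMono (mulMono a b) (mulMono c d)  ≡⟨ mulMono-assoc a b (mulMono c d) ⟩
  mulMono a (mulMono b (mulMono c d))  ≡⟨ cong (mulMono a) (mulMono-left-comm b c d) ⟩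
  mulMono a (mulMono c (mulMono b d))  ≡⟨ mulMono-assoc a c (mulMono b d) ⟨
  mulMono (mulMono a c) (mulMono b d)  ∎
  where open ≡-Reasoning

sum-insertD : ∀ x l → sum (insertD x l) ≡ x ℕ.+ sum l
sum-insertD x []       = refl
sum-insertD x (y ∷ ys) with y <ᵇ x
... | true  = refl
... | false = trans (cong (y ℕ.+_) (sum-insertD x ys)) (left-comm y x (sum ys))
  where
  left-comm : ∀ a b c → a ℕ.+ (b ℕ.+ c) ≡ b ℕ.+ (a ℕ.+ c)
  left-comm a b c = trans (sym (ℕₚ.+-assoc a b c)) (trans (cong (ℕ._+ c) (ℕₚ.+-comm a b)) (ℕₚ.+-assoc b a c))

sum-mulMono : ∀ m n → sum (mulMono m n) ≡ sum m ℕ.+ sum n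
sum-mulMono []      n = refl
sum-mulMono (x ∷ m) n = trans (sum-insertD x (mulMono m n))
  (trans (cong (x ℕ.+_) (sum-mulMono m n)) (sym (ℕₚ.+-assoc x (sum m) (sum n))))

-- mulMono m [] is the insertion sort of m, so 1S is a right unit only on terms whose
-- monomials are already weakly decreasing.
Sorted : Mono → Set
Sorted m = mulMono m [] ≡ m

mulMono-sorted : ∀ m {n} → Sorted n → Sorted (mulMono m n)
mulMono-sorted m {n} n-sorted = trans (mulMono-assoc m n []) (cong (mulMono m) n-sorted)

Terms : (Mono → Set) → Sym → Set
Terms Q = All (Q ∘ proj₂)

Supported : (Mono → Set) → Sym → Set
Supported Q p = ∀ {F G} → (∀ {m} → Q m → F m ≡ G m) → ⟪ p ⟫ F ≡ ⟪ p ⟫ G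

Terms⇒Supported : ∀ {Q p} → Terms Q p → Supported Q p
Terms⇒Supported {p = []}          []        F≗G = refl
Terms⇒Supported {p = (c , m) ∷ p} (Qm ∷ Qp) F≗G = cong₂ _+_ (cong (c *_) (F≗G Qm)) (Terms⇒Supported Qp F≗G)

Supported-*S : ∀ {Q₁ Q₂ Q₃ p q} → (∀ {m n} → Q₁ m → Q₂ n → Q₃ (mulMono m n)) →
  Supported Q₁ p → Supported Q₂ q → Supported Q₃ (p *S q)
Supported-*S {p = p} {q} mul p-supp q-supp F≗G =
  trans (⟪*S⟫ p q _) (trans (p-supp λ Q₁m → q-supp λ Q₂n → F≗G (mul Q₁m Q₂n)) (sym (⟪*S⟫ p q _)))

Terms-*S : ∀ {Q₁ Q₂ Q₃ p q} → (∀ {m n} → Q₁ m → Q₂ n → Q₃ (mulMono m n)) →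
  Terms Q₁ p → Terms Q₂ q → Terms Q₃ (p *S q)
Terms-*S mul []          q-terms = []
Terms-*S mul (Q₁m ∷ p-terms) q-terms =
  ++⁺ (map⁺ (All.map (mul Q₁m) q-terms)) (Terms-*S mul p-terms q-terms)

Terms-sumS-map : ∀ {Q} {A : Set} {F : A → Sym} → (∀ x → Terms Q (F x)) → ∀ xs → Terms Q (sumS (map F xs))
Terms-sumS-map F-terms xs = concat⁺ (map⁺ (All.universal F-terms xs))

sorted-*S : ∀ p {q} → Terms Sorted q → Terms Sorted (p *S q)
sorted-*S p = Terms-*S {Q₁ = λ _ → Unit} (λ {m} _ → mulMono-sorted m) (All.universal (λ _ → tt) p)

*S-identityʳ : ∀ {p} → Terms Sorted p → p *S 1S ≃ p
*S-identityʳ {p} p-sorted = mk≃ λ G →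
  trans (⟪*S⟫ p 1S G) (trans (⟪⟫-cong p (λ m → ⟪1S⟫ (G ∘ mulMono m))) (Terms⇒Supported p-sorted (cong G)))

*S-assoc : ∀ p q r → (p *S q) *S r ≃ p *S (q *S r)
*S-assoc p q r = mk≃ λ G → begin
  ⟪ (p *S q) *S r ⟫ G
    ≡⟨ trans (⟪*S⟫ (p *S q) r G) (⟪*S⟫ p q _) ⟩
  ⟪ p ⟫ (λ a → ⟪ q ⟫ (λ b → ⟪ r ⟫ (λ c → G (mulMono (mulMono a b) c))))
    ≡⟨ ⟪⟫-cong p (λ a → ⟪⟫-cong q (λ b → ⟪⟫-cong r (λ c → cong G (mulMono-assoc a b c)))) ⟩
  ⟪ p ⟫ (λ a → ⟪ q ⟫ (λ b → ⟪ r ⟫ (λ c → G (mulMono a (mulMono b c)))))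
    ≡⟨ trans (⟪*S⟫ p (q *S r) G) (⟪⟫-cong p (λ a → ⟪*S⟫ q r _)) ⟨
  ⟪ p *S (q *S r) ⟫ G ∎
  where open ≡-Reasoning

*S-interchange : ∀ p q r s → (p *S q) *S (r *S s) ≃ (p *S r) *S (q *S s)
*S-interchange p q r s = mk≃ λ G → begin
  ⟪ (p *S q) *S (r *S s) ⟫ G
    ≡⟨ expand p q r s G ⟩
  ⟪ p ⟫ (λ a → ⟪ q ⟫ (λ b → ⟪ r ⟫ (λ c → ⟪ s ⟫ (λ d → G (mulMono (mulMono a b) (mulMono c d))))))
    ≡⟨ ⟪⟫-cong p (λ a → ⟪⟫-comm q r _) ⟩
  ⟪ p ⟫ (λ a → ⟪ r ⟫ (λ c → ⟪ q ⟫ (λ b → ⟪ s ⟫ (λ d → G (mulMono (mulMono a b) (mulMono c d))))))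
    ≡⟨ ⟪⟫-cong p (λ a → ⟪⟫-cong r (λ c → ⟪⟫-cong q (λ b → ⟪⟫-cong s (λ d →
         cong G (mulMono-interchange a b c d))))) ⟩
  ⟪ p ⟫ (λ a → ⟪ r ⟫ (λ c → ⟪ q ⟫ (λ b → ⟪ s ⟫ (λ d → G (mulMono (mulMono a c) (mulMono b d))))))
    ≡⟨ expand p r q s G ⟨
  ⟪ (p *S r) *S (q *S s) ⟫ G ∎
  where
  open ≡-Reasoning
  expand : ∀ p q r s G → ⟪ (p *S q) *S (r *S s) ⟫ G ≡
    ⟪ p ⟫ (λ a → ⟪ q ⟫ (λ b → ⟪ r ⟫ (λ c → ⟪ s ⟫ (λ d → G (mulMono (mulMono a b) (mulMono c d))))))
  expand p q r s G = trans (⟪*S⟫ (p *S q) (r *S s) G)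
    (trans (⟪*S⟫ p q _) (⟪⟫-cong p λ a → ⟪⟫-cong q λ b → ⟪*S⟫ r s _))

Homogeneous : ℕ → Sym → Set
Homogeneous d = Terms (λ m → sum m ≡ d)

e-homogeneous : ∀ i → Homogeneous i (e i)
e-homogeneous zero    = refl ∷ []
e-homogeneous (suc i) = ℕₚ.+-identityʳ (suc i) ∷ []

hRevStep : ℕ → Sym → Sym
hRevStep i p = scaleS (sgn (i ∸ 1)) (e i *S p)

DescendingHomogeneous : ℕ → List Sym → Set
DescendingHomogeneous d       []       = ⊥
DescendingHomogeneous zero    (p ∷ ps) = Homogeneous 0 p × ps ≡ []
DescendingHomogeneous (suc d) (p ∷ ps) = Homogeneous (suc d) p × DescendingHomogeneous d ps

Homogeneous-*S : ∀ {a b p q} → Homogeneous a p → Homogeneous b q → Homogeneous (a ℕ.+ b) (p *S q)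
Homogeneous-*S = Terms-*S λ {m} {n} deg-m deg-n → trans (sum-mulMono m n) (cong₂ ℕ._+_ deg-m deg-n)

hRevStep-homogeneous : ∀ {i d} p → Homogeneous d p → Homogeneous (i ℕ.+ d) (hRevStep i p)
hRevStep-homogeneous {i} p p-hom = map⁺ (Homogeneous-*S (e-homogeneous i) p-hom)

zipWith-hRevStep-homogeneous : ∀ {d D} (f : ℕ → ℕ) n ps → DescendingHomogeneous d ps →
  (∀ {i} → i ≤ d → f i ℕ.+ (d ∸ i) ≡ D) → All (Homogeneous D) (zipWith hRevStep (applyUpTo f n) ps)
zipWith-hRevStep-homogeneous             f zero          ps       _ _ = []
zipWith-hRevStep-homogeneous {zero}      f (suc zero)    (p ∷ []) (p-hom , refl) deg =
  subst (λ k → Homogeneous k _) (deg z≤n) (hRevStep-homogeneous p p-hom) ∷ []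
zipWith-hRevStep-homogeneous {zero}      f (suc (suc n)) (p ∷ []) (p-hom , refl) deg =
  subst (λ k → Homogeneous k _) (deg z≤n) (hRevStep-homogeneous p p-hom) ∷ []
zipWith-hRevStep-homogeneous {suc d}     f (suc n)       (p ∷ ps) (p-hom , ps-hom) deg =
  subst (λ k → Homogeneous k _) (deg z≤n) (hRevStep-homogeneous p p-hom)
  ∷ zipWith-hRevStep-homogeneous (f ∘ suc) n ps ps-hom (λ i≤d → deg (s≤s i≤d))

hRev-homogeneous : ∀ k → DescendingHomogeneous k (hRev k)
hRev-homogeneous zero    = refl ∷ [] , refl
hRev-homogeneous (suc k) =
  concat⁺ (zipWith-hRevStep-homogeneous suc (suc k) (hRev k) (hRev-homogeneous k) (λ i≤k → cong suc (ℕₚ.m+[n∸m]≡n i≤k)))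
  , hRev-homogeneous k

h-homogeneous : ∀ k → Homogeneous k (h k)
h-homogeneous k = head-homogeneous (hRev k) (hRev-homogeneous k)
  where
  head-homogeneous : ∀ {d} ps → DescendingHomogeneous d ps → Homogeneous d (headS ps)
  head-homogeneous {zero}  (p ∷ ps) (p-hom , _) = p-hom
  head-homogeneous {suc d} (p ∷ ps) (p-hom , _) = p-hom

below : ℕ → (Mono → ℤ) → Mono → ℤ
below N G m = if sum m <ᵇ N then G m else + 0

below-idem : ∀ N G m → below N (below N G) m ≡ below N G m
below-idem N G m with sum m <ᵇ N
... | true  = refl
... | false = refl

below-inside : ∀ N G {m} → sum m < N → below N G m ≡ G m
below-inside N G {m} m<N with sum m <ᵇ N | ℕₚ.<ᵇ-reflects-< (sum m) N
... | true  | _       = refl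
... | false | ofⁿ m≮N = contradiction m<N m≮N

below-outside : ∀ N G {m} → N ≤ sum m → below N G m ≡ + 0
below-outside N G {m} N≤m with sum m <ᵇ N | ℕₚ.<ᵇ-reflects-< (sum m) N
... | false | _       = refl
... | true  | ofʸ m<N = contradiction N≤m (ℕₚ.<⇒≱ m<N)

∑-atDegree : ∀ N G m → (∑[ d ∈ upTo N ] atDegree d G m) ≡ below N G m
∑-atDegree N G m = ∑-upTo-indicator N (sum m) (λ _ → G m)

VanishesBelow : ℕ → Sym → Set
VanishesBelow N p = ∀ G → ⟪ p ⟫ (below N G) ≡ + 0

-- A monomial of degree ≥ a + b is a product in which the first factor has degree ≥ a
-- or the second has degree ≥ b.
*S-vanishesBelow : ∀ {a b p q} → VanishesBelow a p → VanishesBelow b q → VanishesBelow (a ℕ.+ b) (p *S q)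
*S-vanishesBelow {a} {b} {p} {q} p-vanishes q-vanishes G = begin
  ⟪ p *S q ⟫ (below (a ℕ.+ b) G)  ≡⟨ ⟪*S⟫ p q _ ⟩
  ⟪ p ⟫ F                         ≡⟨ ⟪⟫-cong p F≡belowF ⟩
  ⟪ p ⟫ (below a F)               ≡⟨ p-vanishes F ⟩
  + 0                             ∎
  where
  open ≡-Reasoning
  F : Mono → ℤ
  F x = ⟪ q ⟫ (below (a ℕ.+ b) G ∘ mulMono x)
  F≡belowF : ∀ x → F x ≡ below a F x
  F≡belowF x with sum x <ᵇ a | ℕₚ.<ᵇ-reflects-< (sum x) a
  ... | true  | _       = refl
  ... | false | ofⁿ x≮a = trans (⟪⟫-cong q only-below-b) (q-vanishes _)
    where
    only-below-b : ∀ y → below (a ℕ.+ b) G (mulMono x y) ≡ below b (below (a ℕ.+ b) G ∘ mulMono x) y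
    only-below-b y with sum y <ᵇ b | ℕₚ.<ᵇ-reflects-< (sum y) b
    ... | true  | _       = refl
    ... | false | ofⁿ y≮b = below-outside (a ℕ.+ b) G
      (subst (a ℕ.+ b ≤_) (sym (sum-mulMono x y)) (ℕₚ.+-mono-≤ (ℕₚ.≮⇒≥ x≮a) (ℕₚ.≮⇒≥ y≮b)))

mulSer-embed : ∀ p q d → mulSer (embed p) (embed q) d ≃ embed (p *S q) d
mulSer-embed p q d = mk≃ λ G → begin
  ⟪ mulSer (embed p) (embed q) d ⟫ G
    ≡⟨ ⟪sumS-map⟫ (λ i → homog i p *S homog (d ∸ i) q) (upTo (suc d)) G ⟩
  (∑[ i ∈ upTo (suc d) ] ⟪ homog i p *S homog (d ∸ i) q ⟫ G)
    ≡⟨ ∑-cong (upTo (suc d)) (expand G) ⟩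
  (∑[ i ∈ upTo (suc d) ] ⟪ p ⟫ (λ m → ⟪ q ⟫ (λ n → Conv G i m n)))
    ≡⟨ ⟪⟫-∑ᴳ p (upTo (suc d)) _ ⟨
  ⟪ p ⟫ (λ m → ∑[ i ∈ upTo (suc d) ] ⟪ q ⟫ (λ n → Conv G i m n))
    ≡⟨ ⟪⟫-cong p (λ m → ⟪⟫-∑ᴳ q (upTo (suc d)) _) ⟨
  ⟪ p ⟫ (λ m → ⟪ q ⟫ (λ n → ∑[ i ∈ upTo (suc d) ] Conv G i m n))
    ≡⟨ ⟪⟫-cong p (λ m → ⟪⟫-cong q (λ n → trans (∑-upTo-convolution d (sum m) (sum n) _)
         (cong (λ k → if k ≡ᵇ d then G (mulMono m n) else + 0) (sym (sum-mulMono m n))))) ⟩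
  ⟪ p ⟫ (λ m → ⟪ q ⟫ (atDegree d G ∘ mulMono m))
    ≡⟨ ⟪*S⟫ p q _ ⟨
  ⟪ p *S q ⟫ (atDegree d G)
    ≡⟨ ⟪homog⟫ d (p *S q) G ⟨
  ⟪ embed (p *S q) d ⟫ G ∎
  where
  open ≡-Reasoning
  Conv : (Mono → ℤ) → ℕ → Mono → Mono → ℤ
  Conv G i m n = if sum m ≡ᵇ i then (if sum n ≡ᵇ d ∸ i then G (mulMono m n) else + 0) else + 0
  expand : ∀ G i → ⟪ homog i p *S homog (d ∸ i) q ⟫ G ≡ ⟪ p ⟫ (λ m → ⟪ q ⟫ (λ n → Conv G i m n))
  expand G i = begin
    ⟪ homog i p *S homog (d ∸ i) q ⟫ G
      ≡⟨ ⟪*S⟫ (homog i p) (homog (d ∸ i) q) G ⟩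
    ⟪ homog i p ⟫ (λ m → ⟪ homog (d ∸ i) q ⟫ (G ∘ mulMono m))
      ≡⟨ ⟪homog⟫ i p _ ⟩
    ⟪ p ⟫ (atDegree i (λ m → ⟪ homog (d ∸ i) q ⟫ (G ∘ mulMono m)))
      ≡⟨ ⟪⟫-cong p (λ m → trans (cong (if sum m ≡ᵇ i then_else + 0) (⟪homog⟫ (d ∸ i) q _))
           (sym (⟪⟫-ifᴳ q (sum m ≡ᵇ i) _))) ⟩
    ⟪ p ⟫ (λ m → ⟪ q ⟫ (λ n → Conv G i m n)) ∎

mulSer-cong : ∀ {f f′ g g′ : Series} d → (∀ {i} → i ≤ d → f i ≃ f′ i) → (∀ {i} → i ≤ d → g i ≃ g′ i) →
  mulSer f g d ≃ mulSer f′ g′ d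
mulSer-cong {f} {f′} {g} {g′} d f≃f′ g≃g′ = mk≃ λ G → begin
  ⟪ mulSer f g d ⟫ G
    ≡⟨ ⟪sumS-map⟫ (λ i → f i *S g (d ∸ i)) (upTo (suc d)) G ⟩
  (∑[ i ∈ upTo (suc d) ] ⟪ f i *S g (d ∸ i) ⟫ G)
    ≡⟨ ∑-cong-All (applyUpTo⁺₁ (λ i → i) (suc d) λ {i} i<1+d →
         agree (*S-cong (f≃f′ (ℕₚ.≤-pred i<1+d)) (g≃g′ (ℕₚ.m∸n≤m d i))) G) ⟩
  (∑[ i ∈ upTo (suc d) ] ⟪ f′ i *S g′ (d ∸ i) ⟫ G)
    ≡⟨ ⟪sumS-map⟫ (λ i → f′ i *S g′ (d ∸ i)) (upTo (suc d)) G ⟨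
  ⟪ mulSer f′ g′ d ⟫ G ∎
  where open ≡-Reasoning

σ< : ℕ → Sym
σ< M = sumS (map σ (upTo M))

σ<^ : ℕ → ℕ → Sym
σ<^ M zero    = 1S
σ<^ M (suc r) = σ< M *S σ<^ M r

≡ᵇ-sym : ∀ m n → (m ≡ᵇ n) ≡ (n ≡ᵇ m)
≡ᵇ-sym zero    zero    = refl
≡ᵇ-sym zero    (suc n) = refl
≡ᵇ-sym (suc m) zero    = refl
≡ᵇ-sym (suc m) (suc n) = ≡ᵇ-sym m n

σ≃σ< : ∀ {M i} → i < M → σ i ≃ embed (σ< M) i
σ≃σ< {M} {i} i<M = mk≃ λ G → sym (begin
  ⟪ homog i (σ< M) ⟫ G
    ≡⟨ ⟪homog⟫ i (σ< M) G ⟩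
  ⟪ σ< M ⟫ (atDegree i G)
    ≡⟨ ⟪sumS-map⟫ σ (upTo M) _ ⟩
  (∑[ j ∈ upTo M ] ⟪ h j ⟫ (atDegree i G))
    ≡⟨ ∑-cong (upTo M) (component G) ⟩
  (∑[ j ∈ upTo M ] (if i ≡ᵇ j then ⟪ h j ⟫ G else + 0))
    ≡⟨ ∑-upTo-indicator M i (λ j → ⟪ h j ⟫ G) ⟩
  (if i <ᵇ M then ⟪ h i ⟫ G else + 0)
    ≡⟨ cong (if_then ⟪ h i ⟫ G else + 0) (<⇒<ᵇ≡true i<M) ⟩
  ⟪ h i ⟫ G ∎)
  where
  open ≡-Reasoning
  <⇒<ᵇ≡true : ∀ {m n} → m < n → (m <ᵇ n) ≡ true
  <⇒<ᵇ≡true {m} {n} m<n with m <ᵇ n | ℕₚ.<ᵇ-reflects-< m n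
  ... | true  | _       = refl
  ... | false | ofⁿ m≮n = contradiction m<n m≮n
  component : ∀ G j → ⟪ h j ⟫ (atDegree i G) ≡ (if i ≡ᵇ j then ⟪ h j ⟫ G else + 0)
  component G j = trans
    (Terms⇒Supported (h-homogeneous j) λ {m} deg-m →
      trans (cong (λ k → if k ≡ᵇ i then G m else + 0) deg-m) (cong (if_then G m else + 0) (≡ᵇ-sym j i)))
    (⟪⟫-ifᴳ (h j) (i ≡ᵇ j) G)

powSer-σ : ∀ {M j} r → j < M → powSer σ r j ≃ embed (σ<^ M r) j
powSer-σ         zero    j<M = ≃-refl
powSer-σ {M} {j} (suc r) j<M = ≃-trans
  (mulSer-cong {σ} {embed (σ< M)} {powSer σ r} {embed (σ<^ M r)} j (λ i≤j → σ≃σ< (ℕₚ.≤-<-trans i≤j j<M)) (λ k≤j → powSer-σ r (ℕₚ.≤-<-trans k≤j j<M)))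
  (mulSer-embed (σ< M) (σ<^ M r) j)

mulSer-embed-powSer-σ : ∀ M p r {d} → d < M → mulSer (embed p) (powSer σ r) d ≃ embed (p *S σ<^ M r) d
mulSer-embed-powSer-σ M p r {d} d<M = ≃-trans
  (mulSer-cong {embed p} {embed p} {powSer σ r} {embed (σ<^ M r)} d (λ _ → ≃-refl) (λ k≤d → powSer-σ r (ℕₚ.≤-<-trans k≤d d<M)))
  (mulSer-embed p (σ<^ M r) d)

σ<^-+ : ∀ M a b → σ<^ M (a ℕ.+ b) ≃ σ<^ M a *S σ<^ M b
σ<^-+ M zero    b = ≃-sym (*S-identityˡ (σ<^ M b))
σ<^-+ M (suc a) b = ≃-trans (*S-cong (≃-refl {σ< M}) (σ<^-+ M a b)) (≃-sym (*S-assoc (σ< M) (σ<^ M a) (σ<^ M b)))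

powSer-σ-sorted : ∀ r k → Terms Sorted (powSer σ r k)
powSer-σ-sorted zero    k = filter⁺ (λ t → T? (sum (proj₂ t) ≡ᵇ k)) {xs = 1S} (refl ∷ [])
powSer-σ-sorted (suc r) k = Terms-sumS-map (λ i → sorted-*S (σ i) (powSer-σ-sorted r (k ∸ i))) (upTo (suc k))

infix 2 ∑⊆ ∑⊊

∑⊆ : ∀ {n} → Subset n → (Subset n → ℤ) → ℤ
∑⊆ {n} A f = ∑[ B ∈ allSubsets n ] (if subsetᵇ B A then f B else + 0)

∑⊊ : ∀ {n} → Subset n → (Subset n → ℤ) → ℤ
∑⊊ {n} A f = ∑[ B ∈ allSubsets n ] (if properSubᵇ B A then f B else + 0)

syntax ∑⊆ A (λ B → t) = ∑[ B ⊆ A ] t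
syntax ∑⊊ A (λ B → t) = ∑[ B ⊊ A ] t

if-cong : ∀ b {x y : ℤ} → (T b → x ≡ y) → (if b then x else + 0) ≡ (if b then y else + 0)
if-cong true  x≡y = x≡y tt
if-cong false x≡y = refl

subsetᵇ⇒⊆ : ∀ {n} (B A : Subset n) → T (subsetᵇ B A) → B Sub.⊆ A
subsetᵇ⇒⊆ (false ∷ B) (_ ∷ A)     B⊆A (there x∈B) = there (subsetᵇ⇒⊆ B A B⊆A x∈B)
subsetᵇ⇒⊆ (true ∷ B)  (true ∷ A)  B⊆A here        = here
subsetᵇ⇒⊆ (true ∷ B)  (true ∷ A)  B⊆A (there x∈B) = there (subsetᵇ⇒⊆ B A B⊆A x∈B)

properSubᵇ⇒ : ∀ {n} (B A : Subset n) → T (properSubᵇ B A) → T (subsetᵇ B A) × T (not (subsetᵇ A B))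
properSubᵇ⇒ B A with subsetᵇ B A | subsetᵇ A B
... | true | false = λ _ → tt , tt

properSubᵇ⇒∣∣< : ∀ {n} (B A : Subset n) → T (properSubᵇ B A) → ∣ B ∣ < ∣ A ∣
properSubᵇ⇒∣∣< B A B⊂A = strict B A (proj₁ (properSubᵇ⇒ B A B⊂A)) (proj₂ (properSubᵇ⇒ B A B⊂A))
  where
  strict : ∀ {n} (B A : Subset n) → T (subsetᵇ B A) → T (not (subsetᵇ A B)) → ∣ B ∣ < ∣ A ∣
  strict []          []          _   ()
  strict (false ∷ B) (false ∷ A) B⊆A A⊈B = strict B A B⊆A A⊈B
  strict (false ∷ B) (true ∷ A)  B⊆A _   = s≤s (Subₚ.p⊆q⇒∣p∣≤∣q∣ (subsetᵇ⇒⊆ B A B⊆A))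
  strict (true ∷ B)  (true ∷ A)  B⊆A A⊈B = s≤s (strict B A B⊆A A⊈B)

∑-allSubsets-suc : ∀ n (F : Subset (suc n) → ℤ) →
  (∑[ S ∈ allSubsets (suc n) ] F S) ≡ (∑[ B ∈ allSubsets n ] F (true ∷ B)) + (∑[ B ∈ allSubsets n ] F (false ∷ B))
∑-allSubsets-suc n F = trans (∑-++ (map (true ∷_) (allSubsets n)) _ F)
  (cong₂ _+_ (∑-map (true ∷_) (allSubsets n) F) (∑-map (false ∷_) (allSubsets n) F))

∑-allSubsets-++ : ∀ m {n} (F : Subset (m ℕ.+ n) → ℤ) →
  (∑[ S ∈ allSubsets (m ℕ.+ n) ] F S) ≡ (∑[ A ∈ allSubsets m ] ∑[ B ∈ allSubsets n ] F (A Vec.++ B))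
∑-allSubsets-++ zero    F = sym (ℤₚ.+-identityʳ _)
∑-allSubsets-++ (suc m) F = begin
  (∑[ S ∈ allSubsets (suc m ℕ.+ _) ] F S)
    ≡⟨ ∑-allSubsets-suc _ F ⟩
  (∑[ S ∈ allSubsets (m ℕ.+ _) ] F (true ∷ S)) + (∑[ S ∈ allSubsets (m ℕ.+ _) ] F (false ∷ S))
    ≡⟨ cong₂ _+_ (∑-allSubsets-++ m (F ∘ (true ∷_))) (∑-allSubsets-++ m (F ∘ (false ∷_))) ⟩
  (∑[ A ∈ allSubsets m ] ∑[ B ∈ allSubsets _ ] F (true ∷ A Vec.++ B))
    + (∑[ A ∈ allSubsets m ] ∑[ B ∈ allSubsets _ ] F (false ∷ A Vec.++ B))
    ≡⟨ ∑-allSubsets-suc m _ ⟨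
  (∑[ A ∈ allSubsets (suc m) ] ∑[ B ∈ allSubsets _ ] F (A Vec.++ B)) ∎
  where open ≡-Reasoning

∑-eqSubᵇ : ∀ {n} (A : Subset n) (F : Subset n → ℤ) → (∑[ B ∈ allSubsets n ] (if eqSubᵇ B A then F B else + 0)) ≡ F A
∑-eqSubᵇ {zero}  []          F = ℤₚ.+-identityʳ _
∑-eqSubᵇ {suc n} (true ∷ A)  F = begin
  _ ≡⟨ ∑-allSubsets-suc n _ ⟩
  (∑[ B ∈ allSubsets n ] (if eqSubᵇ B A then F (true ∷ B) else + 0))
    + (∑[ B ∈ allSubsets n ] (if subsetᵇ B A ∧ false then F (false ∷ B) else + 0))
    ≡⟨ cong₂ _+_ (∑-eqSubᵇ A (F ∘ (true ∷_)))
         (trans (∑-cong (allSubsets n) (λ B → cong (if_then F (false ∷ B) else + 0) (∧-zeroʳ (subsetᵇ B A))))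
                (∑-0 (allSubsets n))) ⟩
  F (true ∷ A) + + 0 ≡⟨ ℤₚ.+-identityʳ _ ⟩
  F (true ∷ A) ∎
  where open ≡-Reasoning
∑-eqSubᵇ {suc n} (false ∷ A) F =
  trans (∑-allSubsets-suc n _) (trans (cong₂ _+_ (∑-0 (allSubsets n)) (∑-eqSubᵇ A (F ∘ (false ∷_)))) (ℤₚ.+-identityˡ _))

indicator-⊆ : ∀ {n} (B A : Subset n) v →
  (if subsetᵇ B A then v else + 0) ≡ (if properSubᵇ B A then v else + 0) + (if eqSubᵇ B A then v else + 0)
indicator-⊆ B A v with subsetᵇ B A | subsetᵇ A B
... | true  | true  = sym (ℤₚ.+-identityˡ v)
... | true  | false = sym (ℤₚ.+-identityʳ v)
... | false | _     = refl

indicator-⊊ : ∀ {n} (B A : Subset n) v →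
  (if properSubᵇ B A then v else + 0) ≡ (if subsetᵇ B A then v else + 0) - (if eqSubᵇ B A then v else + 0)
indicator-⊊ B A v with subsetᵇ B A | subsetᵇ A B
... | true  | true  = sym (ℤₚ.+-inverseʳ v)
... | true  | false = sym (ℤₚ.+-identityʳ v)
... | false | _     = refl

∑⊆-split : ∀ {n} (A : Subset n) f → (∑[ B ⊆ A ] f B) ≡ (∑[ B ⊊ A ] f B) + f A
∑⊆-split {n} A f = trans (∑-cong (allSubsets n) (λ B → indicator-⊆ B A (f B)))
  (trans (∑-+ (allSubsets n) _ _) (cong (_+_ (∑[ B ⊊ A ] f B)) (∑-eqSubᵇ A f)))

subsetᵇ-++ : ∀ {m n} (A′ A : Subset m) (B′ B : Subset n) →
  subsetᵇ (A′ Vec.++ B′) (A Vec.++ B) ≡ subsetᵇ A′ A ∧ subsetᵇ B′ B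
subsetᵇ-++ []          []      B′ B = refl
subsetᵇ-++ (false ∷ A′) (_ ∷ A) B′ B = subsetᵇ-++ A′ A B′ B
subsetᵇ-++ (true ∷ A′)  (x ∷ A) B′ B =
  trans (cong (x ∧_) (subsetᵇ-++ A′ A B′ B)) (sym (∧-assoc x (subsetᵇ A′ A) (subsetᵇ B′ B)))

eqSubᵇ-++ : ∀ {m n} (A′ A : Subset m) (B′ B : Subset n) →
  eqSubᵇ (A′ Vec.++ B′) (A Vec.++ B) ≡ eqSubᵇ A′ A ∧ eqSubᵇ B′ B
eqSubᵇ-++ A′ A B′ B = trans (cong₂ _∧_ (subsetᵇ-++ A′ A B′ B) (subsetᵇ-++ A A′ B B′))
  (∧-interchange (subsetᵇ A′ A) (subsetᵇ B′ B) (subsetᵇ A A′) (subsetᵇ B B′))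
  where
  ∧-interchange : ∀ a b c d → (a ∧ b) ∧ (c ∧ d) ≡ (a ∧ c) ∧ (b ∧ d)
  ∧-interchange true  b true  d = refl
  ∧-interchange true  b false d = ∧-zeroʳ b
  ∧-interchange false b c     d = refl

if-∧ : ∀ a b (v : ℤ) → (if a ∧ b then v else + 0) ≡ (if a then (if b then v else + 0) else + 0)
if-∧ true  b v = refl
if-∧ false b v = refl

∑-properSubᵇ-++ : ∀ {m n} (A : Subset m) (B : Subset n) (f : Subset m → Subset n → ℤ) →
  (∑[ A′ ∈ allSubsets m ] ∑[ B′ ∈ allSubsets n ] (if properSubᵇ (A′ Vec.++ B′) (A Vec.++ B) then f A′ B′ else + 0))
    ≡ (∑[ A′ ⊆ A ] ∑[ B′ ⊆ B ] f A′ B′) - f A B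
∑-properSubᵇ-++ {m} {n} A B f = begin
  (∑[ A′ ∈ allSubsets m ] ∑[ B′ ∈ allSubsets n ] (if properSubᵇ (A′ Vec.++ B′) (A Vec.++ B) then f A′ B′ else + 0))
    ≡⟨ ∑-cong (allSubsets m) (λ A′ → ∑-cong (allSubsets n) (λ B′ →
         trans (indicator-⊊ (A′ Vec.++ B′) (A Vec.++ B) (f A′ B′))
               (cong₂ (λ s t → (if s then f A′ B′ else + 0) - (if t then f A′ B′ else + 0))
                      (subsetᵇ-++ A′ A B′ B) (eqSubᵇ-++ A′ A B′ B)))) ⟩
  (∑[ A′ ∈ allSubsets m ] ∑[ B′ ∈ allSubsets n ] ((if subsetᵇ A′ A ∧ subsetᵇ B′ B then f A′ B′ else + 0)
                                                 - (if eqSubᵇ A′ A ∧ eqSubᵇ B′ B then f A′ B′ else + 0)))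
    ≡⟨ ∑-cong (allSubsets m) (λ A′ → ∑-- (allSubsets n) (λ B′ → if subsetᵇ A′ A ∧ subsetᵇ B′ B then f A′ B′ else + 0)
                                                         (λ B′ → if eqSubᵇ A′ A ∧ eqSubᵇ B′ B then f A′ B′ else + 0)) ⟩
  (∑[ A′ ∈ allSubsets m ] ((∑[ B′ ∈ allSubsets n ] (if subsetᵇ A′ A ∧ subsetᵇ B′ B then f A′ B′ else + 0))
                          - (∑[ B′ ∈ allSubsets n ] (if eqSubᵇ A′ A ∧ eqSubᵇ B′ B then f A′ B′ else + 0))))
    ≡⟨ ∑-- (allSubsets m) (λ A′ → ∑[ B′ ∈ allSubsets n ] (if subsetᵇ A′ A ∧ subsetᵇ B′ B then f A′ B′ else + 0))
                          (λ A′ → ∑[ B′ ∈ allSubsets n ] (if eqSubᵇ A′ A ∧ eqSubᵇ B′ B then f A′ B′ else + 0)) ⟩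
  (∑[ A′ ∈ allSubsets m ] ∑[ B′ ∈ allSubsets n ] (if subsetᵇ A′ A ∧ subsetᵇ B′ B then f A′ B′ else + 0))
    - (∑[ A′ ∈ allSubsets m ] ∑[ B′ ∈ allSubsets n ] (if eqSubᵇ A′ A ∧ eqSubᵇ B′ B then f A′ B′ else + 0))
    ≡⟨ cong₂ _-_ (∑-cong (allSubsets m) (λ A′ → ∑-if-∧ (subsetᵇ A′ A) (λ B′ → subsetᵇ B′ B) (f A′)))
                 (trans (∑-cong (allSubsets m) (λ A′ → ∑-if-∧ (eqSubᵇ A′ A) (λ B′ → eqSubᵇ B′ B) (f A′)))
                        (trans (∑-eqSubᵇ A (λ A′ → ∑[ B′ ∈ allSubsets n ] (if eqSubᵇ B′ B then f A′ B′ else + 0))) (∑-eqSubᵇ B (f A)))) ⟩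
  (∑[ A′ ⊆ A ] ∑[ B′ ⊆ B ] f A′ B′) - f A B ∎
  where
  open ≡-Reasoning
  ∑-if-∧ : ∀ a (b : Subset n → Bool) (g : Subset n → ℤ) →
    (∑[ B′ ∈ allSubsets n ] (if a ∧ b B′ then g B′ else + 0)) ≡ (if a then (∑[ B′ ∈ allSubsets n ] (if b B′ then g B′ else + 0)) else + 0)
  ∑-if-∧ a b g = trans (∑-cong (allSubsets n) (λ B′ → if-∧ a (b B′) (g B′))) (∑-if (allSubsets n) a _)

module _ {n} (rk : Subset n → ℕ) where

  -- Names for the summand and for the series S in the where-clause of Pfuel: for A ≠ ∅,
  -- Pfuel rk (suc k) A unfolds to sumS (map (fuelSlice k A) (upTo ∣ A ∣)).
  fuelTerm : ℕ → Subset n → Subset n → Series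
  fuelTerm k A B = scaleSer (sgn (∣ A ∣ ∸ ∣ B ∣)) (mulSer (embed (Pfuel rk k B)) (powSer σ (rk A ∸ rk B)))

  properSubsets : Subset n → List (Subset n)
  properSubsets A = filterᵇ (λ B → properSubᵇ B A) (allSubsets n)

  fuelSlice : ℕ → Subset n → Series
  fuelSlice k A = negSer (sumSer (map (fuelTerm k A) (properSubsets A)))

  Pfuel-stable : ∀ k A → ∣ A ∣ ≤ k → Pfuel rk k A ≡ Pfuel rk (suc k) A
  Pfuel-stable zero    A |A|≤0 rewrite ℕₚ.n≤0⇒n≡0 |A|≤0 = refl
  Pfuel-stable (suc k) A |A|≤1+k =
    cong (if ∣ A ∣ ≡ᵇ 0 then 1S else_) (cong sumS (Listₚ.map-cong slice-stable (upTo ∣ A ∣)))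
    where
    term-stable : ∀ {B} → T (properSubᵇ B A) → fuelTerm k A B ≡ fuelTerm (suc k) A B
    term-stable {B} B⊂A = cong (λ P → scaleSer (sgn (∣ A ∣ ∸ ∣ B ∣)) (mulSer (embed P) (powSer σ (rk A ∸ rk B))))
      (Pfuel-stable k B (ℕₚ.≤-pred (ℕₚ.≤-trans (properSubᵇ⇒∣∣< B A B⊂A) |A|≤1+k)))
    slice-stable : ∀ d → fuelSlice k A d ≡ fuelSlice (suc k) A d
    slice-stable d = cong (λ Fs → negS (sumS (map (λ F → F d) Fs)))
      (Listₚ.map-cong-local (All.map term-stable (all-filter (λ B → T? (properSubᵇ B A)) (allSubsets n))))

  Pfuel-sorted : ∀ k A → Terms Sorted (Pfuel rk k A)
  Pfuel-sorted zero    A = refl ∷ []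
  Pfuel-sorted (suc k) A with ∣ A ∣ ≡ᵇ 0
  ... | true  = refl ∷ []
  ... | false = Terms-sumS-map slice-sorted (upTo ∣ A ∣)
    where
    slice-sorted : ∀ d → Terms Sorted (fuelSlice k A d)
    slice-sorted d = map⁺ (concat⁺ (map⁺ (map⁺ (All.universal (λ B →
      map⁺ (Terms-sumS-map (λ i → sorted-*S (homog i (Pfuel rk k B)) (powSer-σ-sorted (rk A ∸ rk B) (d ∸ i))) (upTo (suc d))))
      (properSubsets A)))))

Prestr-sorted : ∀ {n} (rk : Subset n → ℕ) A → Terms Sorted (Prestr rk A)
Prestr-sorted {n} rk = Pfuel-sorted rk n

Prestr-empty : ∀ {n} (rk : Subset n → ℕ) A → ∣ A ∣ ≡ 0 → Prestr rk A ≡ 1S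
Prestr-empty {zero}  rk A _     = refl
Prestr-empty {suc n} rk A |A|≡0 rewrite |A|≡0 = refl

-- (-1)^{|A|-|B|} 𝒫[X|_B] σ^{rk A - rk B}, with σ truncated below degree M.
term : ∀ {n} → (Subset n → ℕ) → ℕ → Subset n → Subset n → Sym
term rk M A B = scaleS (sgn (∣ A ∣ ∸ ∣ B ∣)) (Prestr rk B *S σ<^ M (rk A ∸ rk B))

term-self : ∀ {n} (rk : Subset n → ℕ) M A → term rk M A A ≃ Prestr rk A
term-self rk M A = mk≃ λ G → begin
  ⟪ term rk M A A ⟫ G
    ≡⟨ ⟪scaleS⟫ (sgn (∣ A ∣ ∸ ∣ A ∣)) (Prestr rk A *S σ<^ M (rk A ∸ rk A)) G ⟩
  sgn (∣ A ∣ ∸ ∣ A ∣) * ⟪ Prestr rk A *S σ<^ M (rk A ∸ rk A) ⟫ G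
    ≡⟨ cong₂ (λ c r → sgn c * ⟪ Prestr rk A *S σ<^ M r ⟫ G) (ℕₚ.n∸n≡0 ∣ A ∣) (ℕₚ.n∸n≡0 (rk A)) ⟩
  + 1 * ⟪ Prestr rk A *S 1S ⟫ G
    ≡⟨ ℤₚ.*-identityˡ _ ⟩
  ⟪ Prestr rk A *S 1S ⟫ G
    ≡⟨ agree (*S-identityʳ (Prestr-sorted rk A)) G ⟩
  ⟪ Prestr rk A ⟫ G ∎
  where open ≡-Reasoning

⟪negSer-sumSer⟫ : ∀ {A : Set} (F : A → Series) xs d G → ⟪ negSer (sumSer (map F xs)) d ⟫ G ≡ - (∑[ x ∈ xs ] ⟪ F x d ⟫ G)
⟪negSer-sumSer⟫ F xs d G =
  trans (⟪negS⟫ (sumSer (map F xs) d) G) (cong -_ (trans (⟪sumS-map⟫ (λ f → f d) (map F xs) G) (∑-map F xs _)))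

∑-fuelTerm : ∀ {k} (rk : Subset (suc k) → ℕ) M (A B : Subset (suc k)) → ∣ A ∣ ≤ M → T (properSubᵇ B A) → ∀ G →
  (∑[ d ∈ upTo ∣ A ∣ ] ⟪ fuelTerm rk k A B d ⟫ G) ≡ ⟪ term rk M A B ⟫ (below ∣ A ∣ G)
∑-fuelTerm {k} rk M A B |A|≤M B⊂A G = begin
  (∑[ d ∈ upTo ∣ A ∣ ] ⟪ fuelTerm rk k A B d ⟫ G)
    ≡⟨ ∑-cong-All (applyUpTo⁺₁ (λ d → d) ∣ A ∣ slice) ⟩
  (∑[ d ∈ upTo ∣ A ∣ ] c * ⟪ X ⟫ (atDegree d G))
    ≡⟨ ∑-*ˡ (upTo ∣ A ∣) c _ ⟩
  c * (∑[ d ∈ upTo ∣ A ∣ ] ⟪ X ⟫ (atDegree d G))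
    ≡⟨ cong (c *_) (⟪⟫-∑ᴳ X (upTo ∣ A ∣) (λ d → atDegree d G)) ⟨
  c * ⟪ X ⟫ (λ m → ∑[ d ∈ upTo ∣ A ∣ ] atDegree d G m)
    ≡⟨ cong (c *_) (⟪⟫-cong X (∑-atDegree ∣ A ∣ G)) ⟩
  c * ⟪ X ⟫ (below ∣ A ∣ G)
    ≡⟨ cong (λ P → c * ⟪ P *S σ<^ M (rk A ∸ rk B) ⟫ (below ∣ A ∣ G)) (Pfuel-stable rk k B |B|≤k) ⟩
  c * ⟪ Prestr rk B *S σ<^ M (rk A ∸ rk B) ⟫ (below ∣ A ∣ G)
    ≡⟨ ⟪scaleS⟫ c (Prestr rk B *S σ<^ M (rk A ∸ rk B)) (below ∣ A ∣ G) ⟨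
  ⟪ term rk M A B ⟫ (below ∣ A ∣ G) ∎
  where
  open ≡-Reasoning
  c = sgn (∣ A ∣ ∸ ∣ B ∣)
  X = Pfuel rk k B *S σ<^ M (rk A ∸ rk B)
  slice : ∀ {d} → d < ∣ A ∣ → ⟪ fuelTerm rk k A B d ⟫ G ≡ c * ⟪ X ⟫ (atDegree d G)
  slice {d} d<|A| = trans (⟪scaleS⟫ c (mulSer (embed (Pfuel rk k B)) (powSer σ (rk A ∸ rk B)) d) G) (cong (c *_) (trans
    (agree (mulSer-embed-powSer-σ M (Pfuel rk k B) (rk A ∸ rk B) (ℕₚ.<-≤-trans d<|A| |A|≤M)) G)
    (⟪homog⟫ _ X G)))
  |B|≤k : ∣ B ∣ ≤ k
  |B|≤k = ℕₚ.≤-pred (ℕₚ.≤-trans (properSubᵇ⇒∣∣< B A B⊂A) (Subₚ.∣p∣≤n A))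

-- The defining recursion, with σ truncated below degree M ≥ |A|: the truncation only
-- affects components of degree ≥ |A|, which the recursion discards.
Prestr-recursion : ∀ {n} (rk : Subset n → ℕ) M (A : Subset n) → 0 < ∣ A ∣ → ∣ A ∣ ≤ M → ∀ G →
  ⟪ Prestr rk A ⟫ G ≡ - (∑[ B ⊊ A ] ⟪ term rk M A B ⟫ (below ∣ A ∣ G))
Prestr-recursion {zero}  rk M [] ()
Prestr-recursion {suc k} rk M A 0<|A| |A|≤M G = begin
  ⟪ Pfuel rk (suc k) A ⟫ G
    ≡⟨ cong (λ b → ⟪ if b then 1S else sumS (map (fuelSlice rk k A) (upTo ∣ A ∣)) ⟫ G) (≡ᵇ0-false 0<|A|) ⟩
  ⟪ sumS (map (fuelSlice rk k A) (upTo ∣ A ∣)) ⟫ G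
    ≡⟨ ⟪sumS-map⟫ (fuelSlice rk k A) (upTo ∣ A ∣) G ⟩
  (∑[ d ∈ upTo ∣ A ∣ ] ⟪ fuelSlice rk k A d ⟫ G)
    ≡⟨ ∑-cong (upTo ∣ A ∣) (λ d → ⟪negSer-sumSer⟫ (fuelTerm rk k A) (properSubsets rk A) d G) ⟩
  (∑[ d ∈ upTo ∣ A ∣ ] - (∑[ B ∈ properSubsets rk A ] ⟪ fuelTerm rk k A B d ⟫ G))
    ≡⟨ ∑-neg (upTo ∣ A ∣) _ ⟩
  - (∑[ d ∈ upTo ∣ A ∣ ] ∑[ B ∈ properSubsets rk A ] ⟪ fuelTerm rk k A B d ⟫ G)
    ≡⟨ cong -_ (∑-comm (upTo ∣ A ∣) (properSubsets rk A) _) ⟩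
  - (∑[ B ∈ properSubsets rk A ] ∑[ d ∈ upTo ∣ A ∣ ] ⟪ fuelTerm rk k A B d ⟫ G)
    ≡⟨ cong -_ (∑-cong-All (All.map (λ B⊂A → ∑-fuelTerm rk M A _ |A|≤M B⊂A G)
                                    (all-filter (λ B → T? (properSubᵇ B A)) (allSubsets (suc k))))) ⟩
  - (∑[ B ∈ properSubsets rk A ] ⟪ term rk M A B ⟫ (below ∣ A ∣ G))
    ≡⟨ cong -_ (∑-filterᵇ (λ B → properSubᵇ B A) (allSubsets (suc k)) _) ⟩
  - (∑[ B ⊊ A ] ⟪ term rk M A B ⟫ (below ∣ A ∣ G)) ∎
  where
  open ≡-Reasoning
  ≡ᵇ0-false : ∀ {a} → 0 < a → (a ≡ᵇ 0) ≡ false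
  ≡ᵇ0-false (s≤s _) = refl

Prestr-below : ∀ {n} (rk : Subset n → ℕ) A → 0 < ∣ A ∣ → ∀ G → ⟪ Prestr rk A ⟫ G ≡ ⟪ Prestr rk A ⟫ (below ∣ A ∣ G)
Prestr-below {n} rk A 0<|A| G = trans (Prestr-recursion rk ∣ A ∣ A 0<|A| ℕₚ.≤-refl G)
  (trans (cong (λ x → - x) (∑-cong (allSubsets n) λ B → cong (if properSubᵇ B A then_else + 0)
           (⟪⟫-cong (term rk ∣ A ∣ A B) (λ m → sym (below-idem ∣ A ∣ G m)))))
         (sym (Prestr-recursion rk ∣ A ∣ A 0<|A| ℕₚ.≤-refl (below ∣ A ∣ G))))

Prestr-degree : ∀ {n} (rk : Subset n → ℕ) A → Supported (λ m → sum m ≤ ℕ.pred ∣ A ∣) (Prestr rk A)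
Prestr-degree rk A {F} {G} F≗G with ∣ A ∣ ℕ.≟ 0
... | yes |A|≡0 rewrite Prestr-empty rk A |A|≡0 = trans (⟪1S⟫ F) (trans (F≗G {[]} z≤n) (sym (⟪1S⟫ G)))
... | no  |A|≢0 = begin
  ⟪ Prestr rk A ⟫ F              ≡⟨ Prestr-below rk A 0<|A| F ⟩
  ⟪ Prestr rk A ⟫ (below ∣ A ∣ F) ≡⟨ ⟪⟫-cong (Prestr rk A) below-agrees ⟩
  ⟪ Prestr rk A ⟫ (below ∣ A ∣ G) ≡⟨ Prestr-below rk A 0<|A| G ⟨
  ⟪ Prestr rk A ⟫ G              ∎
  where
  open ≡-Reasoning
  0<|A| = ℕₚ.n≢0⇒n>0 |A|≢0
  below-agrees : ∀ m → below (∣ A ∣) F m ≡ below (∣ A ∣) G m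
  below-agrees m with sum m <ᵇ ∣ A ∣ | ℕₚ.<ᵇ-reflects-< (sum m) ∣ A ∣
  ... | true  | ofʸ m<|A| = F≗G (ℕₚ.<⇒≤pred m<|A|)
  ... | false | _         = refl

U : ∀ {n} → (Subset n → ℕ) → ℕ → Subset n → Sym
U {n} rk M A = sumS (map (term rk M A) (filterᵇ (λ B → subsetᵇ B A) (allSubsets n)))

⟪U⟫ : ∀ {n} (rk : Subset n → ℕ) M A G → ⟪ U rk M A ⟫ G ≡ (∑[ B ⊆ A ] ⟪ term rk M A B ⟫ G)
⟪U⟫ {n} rk M A G = trans (⟪sumS-map⟫ (term rk M A) (filterᵇ (λ B → subsetᵇ B A) (allSubsets n)) G) (∑-filterᵇ (λ B → subsetᵇ B A) (allSubsets n) _)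

-- The top term of U is 𝒫 itself, which the recursion cancels against the proper terms.
U-vanishesBelow : ∀ {n} (rk : Subset n → ℕ) M A → ∣ A ∣ ≤ M → VanishesBelow ∣ A ∣ (U rk M A)
U-vanishesBelow {n} rk M A |A|≤M G with ∣ A ∣ ℕ.≟ 0
... | yes |A|≡0 = trans (⟪⟫-cong (U rk M A) (λ m → cong (λ N → below N G m) |A|≡0)) (⟪⟫-0ᴳ (U rk M A))
... | no  |A|≢0 = begin
  ⟪ U rk M A ⟫ H                       ≡⟨ ⟪U⟫ rk M A H ⟩
  (∑[ B ⊆ A ] ⟪ term rk M A B ⟫ H)     ≡⟨ ∑⊆-split A _ ⟩
  proper H + ⟪ term rk M A A ⟫ H       ≡⟨ cong (_+_ (proper H)) (agree (term-self rk M A) H) ⟩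
  proper H + ⟪ Prestr rk A ⟫ H         ≡⟨ cong (_+_ (proper H)) (Prestr-recursion rk M A (ℕₚ.n≢0⇒n>0 |A|≢0) |A|≤M H) ⟩
  proper H - proper (below ∣ A ∣ H)    ≡⟨ cong (λ x → proper H - x) (∑-cong (allSubsets n) λ B →
                                            cong (if properSubᵇ B A then_else + 0) (⟪⟫-cong (term rk M A B) (below-idem ∣ A ∣ G))) ⟩
  proper H - proper H                  ≡⟨ ℤₚ.+-inverseʳ (proper H) ⟩
  + 0                                  ∎
  where
  open ≡-Reasoning
  H = below ∣ A ∣ G
  proper : (Mono → ℤ) → ℤ
  proper F = ∑[ B ⊊ A ] ⟪ term rk M A B ⟫ F

∣++∣ : ∀ {m n} (A : Subset m) (B : Subset n) → ∣ A Vec.++ B ∣ ≡ ∣ A ∣ ℕ.+ ∣ B ∣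
∣++∣ []          B = refl
∣++∣ (true ∷ A)  B = cong suc (∣++∣ A B)
∣++∣ (false ∷ A) B = ∣++∣ A B

⊤-++ : ∀ m n → ⊤ {m ℕ.+ n} ≡ ⊤ {m} Vec.++ ⊤ {n}
⊤-++ zero    n = refl
⊤-++ (suc m) n = cong (true ∷_) (⊤-++ m n)

directSum-++ : ∀ {m n} (rkX : Subset m → ℕ) (rkY : Subset n → ℕ) A B →
  directSum rkX rkY (A Vec.++ B) ≡ rkX A ℕ.+ rkY B
directSum-++ {m} rkX rkY A B = cong₂ (λ A′ B′ → rkX A′ ℕ.+ rkY B′) (proj₁ split) (proj₂ split)
  where
  split = Vecₚ.++-injective (Vec.take m (A Vec.++ B)) A (Vecₚ.take++drop≡id m (A Vec.++ B))

sgn-+ : ∀ a b → sgn (a ℕ.+ b) ≡ sgn a * sgn b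
sgn-+ zero    b = sym (ℤₚ.*-identityˡ (sgn b))
sgn-+ (suc a) b = trans (cong -_ (sgn-+ a b)) (ℤₚ.neg-distribˡ-* (sgn a) (sgn b))

[m+n]∸[o+p]≡[m∸o]+[n∸p] : ∀ {m n o p} → o ≤ m → p ≤ n → (m ℕ.+ n) ∸ (o ℕ.+ p) ≡ (m ∸ o) ℕ.+ (n ∸ p)
[m+n]∸[o+p]≡[m∸o]+[n∸p] {m} {n} {o} {p} o≤m p≤n = trans (sym (ℕₚ.∸-+-assoc (m ℕ.+ n) o p))
  (trans (cong (_∸ p) (ℕₚ.+-∸-comm n o≤m)) (ℕₚ.+-∸-assoc (m ∸ o) p≤n))

Monotone : ∀ {n} → (Subset n → ℕ) → Set
Monotone rk = ∀ A B → A Sub.⊆ B → rk A ≤ rk B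

module _ {m n} (rkX : Subset m → ℕ) (rkY : Subset n → ℕ) where

  private
    rkS = directSum rkX rkY
    M   = m ℕ.+ n

  Prestr-directSum-empty : ∀ A B → ∣ A ∣ ℕ.+ ∣ B ∣ ≡ 0 → Prestr rkS (A Vec.++ B) ≃ Prestr rkX A *S Prestr rkY B
  Prestr-directSum-empty A B size≡0 = begin
    Prestr rkS (A Vec.++ B)       ≡⟨ Prestr-empty rkS (A Vec.++ B) (trans (∣++∣ A B) size≡0) ⟩
    1S                            ≈⟨ *S-identityˡ 1S ⟨
    1S *S 1S                      ≡⟨ cong₂ _*S_ (Prestr-empty rkX A (ℕₚ.m+n≡0⇒m≡0 ∣ A ∣ size≡0))
                                                (Prestr-empty rkY B (ℕₚ.m+n≡0⇒n≡0 ∣ A ∣ size≡0)) ⟨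
    Prestr rkX A *S Prestr rkY B  ∎
    where open ≃-Reasoning

  term-directSum : Monotone rkX → Monotone rkY → ∀ {A A′ B B′} → T (subsetᵇ A′ A) → T (subsetᵇ B′ B) →
    Prestr rkS (A′ Vec.++ B′) ≃ Prestr rkX A′ *S Prestr rkY B′ →
    term rkS M (A Vec.++ B) (A′ Vec.++ B′) ≃ term rkX M A A′ *S term rkY M B B′
  term-directSum monoX monoY {A} {A′} {B} {B′} A′⊆A B′⊆B P≃PP = begin
    term rkS M (A Vec.++ B) (A′ Vec.++ B′)
      ≡⟨ cong₂ (λ c r → scaleS c (Prestr rkS (A′ Vec.++ B′) *S σ<^ M r)) sign exponent ⟩
    scaleS (cA * cB) (Prestr rkS (A′ Vec.++ B′) *S σ<^ M (rA ℕ.+ rB))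
      ≈⟨ scaleS-cong (cA * cB) (*S-cong P≃PP (σ<^-+ M rA rB)) ⟩
    scaleS (cA * cB) ((Prestr rkX A′ *S Prestr rkY B′) *S (σ<^ M rA *S σ<^ M rB))
      ≈⟨ scaleS-cong (cA * cB) (*S-interchange (Prestr rkX A′) (Prestr rkY B′) (σ<^ M rA) (σ<^ M rB)) ⟩
    scaleS (cA * cB) ((Prestr rkX A′ *S σ<^ M rA) *S (Prestr rkY B′ *S σ<^ M rB))
      ≈⟨ scaleS-*-scaleS cA cB (Prestr rkX A′ *S σ<^ M rA) (Prestr rkY B′ *S σ<^ M rB) ⟨
    term rkX M A A′ *S term rkY M B B′ ∎
    where
    open ≃-Reasoning
    cA = sgn (∣ A ∣ ∸ ∣ A′ ∣)
    cB = sgn (∣ B ∣ ∸ ∣ B′ ∣)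
    rA = rkX A ∸ rkX A′
    rB = rkY B ∸ rkY B′
    A′⊆ᵗA = subsetᵇ⇒⊆ A′ A A′⊆A
    B′⊆ᵗB = subsetᵇ⇒⊆ B′ B B′⊆B
    sign : sgn (∣ A Vec.++ B ∣ ∸ ∣ A′ Vec.++ B′ ∣) ≡ cA * cB
    sign = trans (cong sgn (trans (cong₂ _∸_ (∣++∣ A B) (∣++∣ A′ B′))
      ([m+n]∸[o+p]≡[m∸o]+[n∸p] (Subₚ.p⊆q⇒∣p∣≤∣q∣ A′⊆ᵗA) (Subₚ.p⊆q⇒∣p∣≤∣q∣ B′⊆ᵗB)))) (sgn-+ (∣ A ∣ ∸ ∣ A′ ∣) (∣ B ∣ ∸ ∣ B′ ∣))
    exponent : rkS (A Vec.++ B) ∸ rkS (A′ Vec.++ B′) ≡ rA ℕ.+ rB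
    exponent = trans (cong₂ _∸_ (directSum-++ rkX rkY A B) (directSum-++ rkX rkY A′ B′))
      ([m+n]∸[o+p]≡[m∸o]+[n∸p] (monoX A′ A A′⊆ᵗA) (monoY B′ B B′⊆ᵗB))

  ⟪U*U⟫ : ∀ A B G → ⟪ U rkX M A *S U rkY M B ⟫ G ≡ (∑[ A′ ⊆ A ] ∑[ B′ ⊆ B ] ⟪ term rkX M A A′ *S term rkY M B B′ ⟫ G)
  ⟪U*U⟫ A B G = begin
    ⟪ U rkX M A *S U rkY M B ⟫ G
      ≡⟨ ⟪*S⟫ (U rkX M A) (U rkY M B) G ⟩
    ⟪ U rkX M A ⟫ (λ x → ⟪ U rkY M B ⟫ (G ∘ mulMono x))
      ≡⟨ ⟪⟫-cong (U rkX M A) (λ x → ⟪U⟫ rkY M B (G ∘ mulMono x)) ⟩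
    ⟪ U rkX M A ⟫ (λ x → ∑[ B′ ⊆ B ] ⟪ term rkY M B B′ ⟫ (G ∘ mulMono x))
      ≡⟨ ⟪U⟫ rkX M A _ ⟩
    (∑[ A′ ⊆ A ] ⟪ term rkX M A A′ ⟫ (λ x → ∑[ B′ ⊆ B ] ⟪ term rkY M B B′ ⟫ (G ∘ mulMono x)))
      ≡⟨ ∑-cong (allSubsets m) (λ A′ → cong (if subsetᵇ A′ A then_else + 0) (trans
           (⟪⟫-∑ᴳ (term rkX M A A′) (allSubsets n) λ B′ x → if subsetᵇ B′ B then ⟪ term rkY M B B′ ⟫ (G ∘ mulMono x) else + 0)
           (∑-cong (allSubsets n) λ B′ → trans (⟪⟫-ifᴳ (term rkX M A A′) (subsetᵇ B′ B) _)
              (cong (if subsetᵇ B′ B then_else + 0) (sym (⟪*S⟫ (term rkX M A A′) (term rkY M B B′) G)))))) ⟩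
    (∑[ A′ ⊆ A ] ∑[ B′ ⊆ B ] ⟪ term rkX M A A′ *S term rkY M B B′ ⟫ G) ∎
    where open ≡-Reasoning

  module _ (monoX : Monotone rkX) (monoY : Monotone rkY) where

    ∑⊊-directSum : ∀ A B →
      (∀ {A′ B′} → T (properSubᵇ (A′ Vec.++ B′) (A Vec.++ B)) → Prestr rkS (A′ Vec.++ B′) ≃ Prestr rkX A′ *S Prestr rkY B′) →
      ∀ G → (∑[ S ⊊ A Vec.++ B ] ⟪ term rkS M (A Vec.++ B) S ⟫ G)
              ≡ ⟪ U rkX M A *S U rkY M B ⟫ G - ⟪ Prestr rkX A *S Prestr rkY B ⟫ G
    ∑⊊-directSum A B IH G = begin
      (∑[ S ⊊ A Vec.++ B ] ⟪ term rkS M (A Vec.++ B) S ⟫ G)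
        ≡⟨ ∑-allSubsets-++ m _ ⟩
      (∑[ A′ ∈ allSubsets m ] ∑[ B′ ∈ allSubsets n ]
         (if properSubᵇ (A′ Vec.++ B′) (A Vec.++ B) then ⟪ term rkS M (A Vec.++ B) (A′ Vec.++ B′) ⟫ G else + 0))
        ≡⟨ ∑-cong (allSubsets m) (λ A′ → ∑-cong (allSubsets n) λ B′ →
             if-cong (properSubᵇ (A′ Vec.++ B′) (A Vec.++ B)) λ S′⊂S →
               let A′⊆A , B′⊆B = split {A′} {B′} S′⊂S in agree (term-directSum monoX monoY A′⊆A B′⊆B (IH {A′} {B′} S′⊂S)) G) ⟩
      (∑[ A′ ∈ allSubsets m ] ∑[ B′ ∈ allSubsets n ]
         (if properSubᵇ (A′ Vec.++ B′) (A Vec.++ B) then Z A′ B′ else + 0))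
        ≡⟨ ∑-properSubᵇ-++ A B Z ⟩
      (∑[ A′ ⊆ A ] ∑[ B′ ⊆ B ] Z A′ B′) - Z A B
        ≡⟨ cong₂ _-_ (sym (⟪U*U⟫ A B G)) (agree (*S-cong (term-self rkX M A) (term-self rkY M B)) G) ⟩
      ⟪ U rkX M A *S U rkY M B ⟫ G - ⟪ Prestr rkX A *S Prestr rkY B ⟫ G ∎
      where
      open ≡-Reasoning
      Z : Subset m → Subset n → ℤ
      Z A′ B′ = ⟪ term rkX M A A′ *S term rkY M B B′ ⟫ G
      split : ∀ {A′ B′} → T (properSubᵇ (A′ Vec.++ B′) (A Vec.++ B)) → T (subsetᵇ A′ A) × T (subsetᵇ B′ B)
      split {A′} {B′} S′⊂S = Equivalence.to T-∧
        (subst T (subsetᵇ-++ A′ A B′ B) (proj₁ (properSubᵇ⇒ (A′ Vec.++ B′) (A Vec.++ B) S′⊂S)))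

    Prestr-directSum-step : ∀ A B → 0 < ∣ A ∣ ℕ.+ ∣ B ∣ →
      (∀ {A′ B′} → T (properSubᵇ (A′ Vec.++ B′) (A Vec.++ B)) → Prestr rkS (A′ Vec.++ B′) ≃ Prestr rkX A′ *S Prestr rkY B′) →
      Prestr rkS (A Vec.++ B) ≃ Prestr rkX A *S Prestr rkY B
    Prestr-directSum-step A B 0<size IH = mk≃ agrees
      where
      PP = Prestr rkX A *S Prestr rkY B
      |A|≤M : ∣ A ∣ ≤ M
      |A|≤M = ℕₚ.≤-trans (Subₚ.∣p∣≤n A) (ℕₚ.m≤m+n m n)
      |B|≤M : ∣ B ∣ ≤ M
      |B|≤M = ℕₚ.≤-trans (Subₚ.∣p∣≤n B) (ℕₚ.m≤n+m n m)
      pred+pred< : ∀ {a b x y} → 0 < a ℕ.+ b → x ≤ ℕ.pred a → y ≤ ℕ.pred b → x ℕ.+ y < a ℕ.+ b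
      pred+pred< {zero}  {suc b} _ z≤n y≤b = s≤s y≤b
      pred+pred< {suc a} {b}     _ x≤a y≤b = s≤s (ℕₚ.+-mono-≤ x≤a (ℕₚ.≤-trans y≤b ℕₚ.pred[n]≤n))
      PP-degree : Supported (λ x → sum x < ∣ A Vec.++ B ∣) PP
      PP-degree = Supported-*S {p = Prestr rkX A} {q = Prestr rkY B}
        (λ {x} {y} x≤ y≤ → subst₂ _<_ (sym (sum-mulMono x y)) (sym (∣++∣ A B)) (pred+pred< {∣ A ∣} {∣ B ∣} 0<size x≤ y≤))
        (Prestr-degree rkX A) (Prestr-degree rkY B)
      UU-vanishes : VanishesBelow ∣ A Vec.++ B ∣ (U rkX M A *S U rkY M B)
      UU-vanishes = subst (λ N → VanishesBelow N (U rkX M A *S U rkY M B)) (sym (∣++∣ A B))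
        (*S-vanishesBelow {∣ A ∣} {∣ B ∣} {U rkX M A} {U rkY M B} (U-vanishesBelow rkX M A |A|≤M) (U-vanishesBelow rkY M B |B|≤M))
      agrees : ∀ G → ⟪ Prestr rkS (A Vec.++ B) ⟫ G ≡ ⟪ PP ⟫ G
      agrees G = begin
        ⟪ Prestr rkS (A Vec.++ B) ⟫ G
          ≡⟨ Prestr-recursion rkS M (A Vec.++ B) (subst (0 <_) (sym (∣++∣ A B)) 0<size) (Subₚ.∣p∣≤n (A Vec.++ B)) G ⟩
        - (∑[ S ⊊ A Vec.++ B ] ⟪ term rkS M (A Vec.++ B) S ⟫ H)
          ≡⟨ cong -_ (∑⊊-directSum A B IH H) ⟩
        - (⟪ U rkX M A *S U rkY M B ⟫ H - ⟪ PP ⟫ H)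
          ≡⟨ cong (λ x → - (x - ⟪ PP ⟫ H)) (UU-vanishes G) ⟩
        - (+ 0 - ⟪ PP ⟫ H)
          ≡⟨ trans (cong -_ (ℤₚ.+-identityˡ _)) (ℤₚ.neg-involutive _) ⟩
        ⟪ PP ⟫ H
          ≡⟨ PP-degree (below-inside ∣ A Vec.++ B ∣ G) ⟩
        ⟪ PP ⟫ G ∎
        where
        open ≡-Reasoning
        H = below ∣ A Vec.++ B ∣ G

    Prestr-directSum : ∀ A B → Prestr rkS (A Vec.++ B) ≃ Prestr rkX A *S Prestr rkY B
    Prestr-directSum A B = bounded (∣ A ∣ ℕ.+ ∣ B ∣) A B ℕₚ.≤-refl
      where
      bounded : ∀ k A B → ∣ A ∣ ℕ.+ ∣ B ∣ ≤ k → Prestr rkS (A Vec.++ B) ≃ Prestr rkX A *S Prestr rkY B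
      bounded zero    A B size≤0 = Prestr-directSum-empty A B (ℕₚ.n≤0⇒n≡0 size≤0)
      bounded (suc k) A B size≤1+k with ∣ A ∣ ℕ.+ ∣ B ∣ ℕ.≟ 0
      ... | yes size≡0 = Prestr-directSum-empty A B size≡0
      ... | no  size≢0 = Prestr-directSum-step A B (ℕₚ.n≢0⇒n>0 size≢0) λ {A′} {B′} S′⊂S →
        bounded k A′ B′ (ℕₚ.≤-pred (ℕₚ.≤-trans
          (subst₂ _<_ (∣++∣ A′ B′) (∣++∣ A B) (properSubᵇ⇒∣∣< (A′ Vec.++ B′) (A Vec.++ B) S′⊂S)) size≤1+k))

coeffQT-∑ : ∀ f a b μ → coeffQT f a b μ ≡
  (∑[ t ∈ f ] (if (proj₁ t ≡ᵇ a) ∧ (proj₁ (proj₂ t) ≡ᵇ b) then coeff (proj₂ (proj₂ t)) μ else + 0))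
coeffQT-∑ []      a b μ = refl
coeffQT-∑ (t ∷ f) a b μ with (proj₁ t ≡ᵇ a) ∧ (proj₁ (proj₂ t) ≡ᵇ b)
... | true  = cong (_+_ (coeff (proj₂ (proj₂ t)) μ)) (coeffQT-∑ f a b μ)
... | false = trans (coeffQT-∑ f a b μ) (sym (ℤₚ.+-identityˡ _))

ℋ-directSum : ∀ {m n} (rkX : Subset m → ℕ) (rkY : Subset n → ℕ) →
  (∀ A B → Prestr (directSum rkX rkY) (A Vec.++ B) ≃ Prestr rkX A *S Prestr rkY B) →
  ℋ (directSum rkX rkY) ≈QT (ℋ rkX *QT ℋ rkY)
ℋ-directSum {m} {n} rkX rkY P≃PP a b μ = begin
  coeffQT (ℋ rkS) a b μ
    ≡⟨ coeffQT-∑ (ℋ rkS) a b μ ⟩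
  (∑[ t ∈ ℋ rkS ] select t)
    ≡⟨ ∑-map _ (allSubsets (m ℕ.+ n)) select ⟩
  (∑[ S ∈ allSubsets (m ℕ.+ n) ] select (rkS S , ∣ S ∣ , Prestr rkS S))
    ≡⟨ ∑-allSubsets-++ m _ ⟩
  (∑[ A ∈ allSubsets m ] ∑[ B ∈ allSubsets n ] select (rkS (A Vec.++ B) , ∣ A Vec.++ B ∣ , Prestr rkS (A Vec.++ B)))
    ≡⟨ ∑-cong (allSubsets m) (λ A → ∑-cong (allSubsets n) (λ B → trans
         (cong₂ (λ r c → select (r , c , Prestr rkS (A Vec.++ B))) (directSum-++ rkX rkY A B) (∣++∣ A B))
         (cong (λ x → if (rkX A ℕ.+ rkY B ≡ᵇ a) ∧ (∣ A ∣ ℕ.+ ∣ B ∣ ≡ᵇ b) then x else + 0) (≃⇒≈S (P≃PP A B) μ)))) ⟩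
  (∑[ A ∈ allSubsets m ] ∑[ B ∈ allSubsets n ] select (rkX A ℕ.+ rkY B , ∣ A ∣ ℕ.+ ∣ B ∣ , Prestr rkX A *S Prestr rkY B))
    ≡⟨ trans (∑-concatMap _ (ℋ rkX) select) (trans (∑-map _ (allSubsets m) _)
         (∑-cong (allSubsets m) (λ A → trans (∑-map _ (ℋ rkY) select) (∑-map _ (allSubsets n) _)))) ⟨
  (∑[ t ∈ ℋ rkX *QT ℋ rkY ] select t)
    ≡⟨ coeffQT-∑ (ℋ rkX *QT ℋ rkY) a b μ ⟨
  coeffQT (ℋ rkX *QT ℋ rkY) a b μ ∎
  where
  open ≡-Reasoning
  rkS = directSum rkX rkY
  select : ℕ × ℕ × Sym → ℤ
  select t = if (proj₁ t ≡ᵇ a) ∧ (proj₁ (proj₂ t) ≡ᵇ b) then coeff (proj₂ (proj₂ t)) μ else + 0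

proposition2p6 : ∀ {m n} (rkX : Subset m → ℕ) (rkY : Subset n → ℕ)
    → IsPolymatroid rkX → IsPolymatroid rkY
    → (𝒫 (directSum rkX rkY) ≈S (𝒫 rkX *S 𝒫 rkY))
    × (ℋ (directSum rkX rkY) ≈QT (ℋ rkX *QT ℋ rkY))
proposition2p6 {m} {n} rkX rkY X-polymatroid Y-polymatroid =
    ≃⇒≈S (subst (λ S → Prestr (directSum rkX rkY) S ≃ 𝒫 rkX *S 𝒫 rkY) (sym (⊤-++ m n)) (P≃PP ⊤ ⊤))
  , ℋ-directSum rkX rkY P≃PP
  where
  P≃PP : ∀ A B → Prestr (directSum rkX rkY) (A Vec.++ B) ≃ Prestr rkX A *S Prestr rkY B
  P≃PP = Prestr-directSum rkX rkY (IsPolymatroid.rk-mono X-polymatroid) (IsPolymatroid.rk-mono Y-polymatroid)
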